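{- Let $V$ be a $v$-dimensional vector space over $\mathrm{GF}(q)$, let $\{\mathbf 0\}=U_0<U_1<\dots<U_v=V$ be a maximal chain of subspaces of $V$, $k\in\{0,\dots,v\}$ and $s\in\{0,\dots,k-1\}$. Then the set of $k$-dimensional subspaces of $V$ is the disjoint union \[\genfrac{[}{]}{0pt}{}{V}{k}_q=\bigcup_{i=0}^{v-k}\genfrac{[}{]}{0pt}{}{U_{v-s-i-1}}{k-s-1}_q *_{U_{v-s-i}/U_{v-s-i-1}}\genfrac{[}{]}{0pt}{}{V/U_{v-s-i}}{s}_q,\] and consequently \[\begin{bmatrix} v\\ k\end{bmatrix}_q=\sum_{i=0}^{v-k} q^{(v-k-i)(s+1)}\begin{bmatrix} v-s-i-1\\ k-s-1\end{bmatrix}_q\begin{bmatrix} s+i\\ s\end{bmatrix}_q.\]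
   Context: $\genfrac{[}{]}{0pt}{}{W}{j}_q$ denotes the set of $j$-dimensional subspaces of a $\mathrm{GF}(q)$-vector space $W$, and $\begin{bmatrix} a\\ b\end{bmatrix}_q$ its size (Gaussian binomial coefficient). For $U_1\le U_2\le V$, a subspace $K\le V$ covers the factor $U_2/U_1$ if $U_1+K=U_2+K$. For $K_1\le U_1$ and $U_2\le K_2\le V$, the covering join is $K_1 *_{U_2/U_1} K_2/U_2=\{K\le V: U_1\cap K=K_1,\ U_2+K=K_2,\ K\text{ covers }U_2/U_1\}$. For a set $\mathcal{B}^{(1)}$ of subspaces of $U_1$ and a set $\mathcal{B}^{(2)}$ of subspaces of $V/U_2$, $\mathcal{B}^{(1)} *_{U_2/U_1}\mathcal{B}^{(2)}$ is the union of $B^{(1)} *_{U_2/U_1} K_2/U_2$ over all $B^{(1)}\in\mathcal{B}^{(1)}$ and all $K_2\ge U_2$ with $K_2/U_2\in\mathcal{B}^{(2)}$ (empty if either set is empty). -}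

module Defs where

open import Level using (Level; _⊔_) renaming (suc to lsuc)
open import Algebra.Bundles using (CommutativeRing)
open import Algebra.Module.Bundles using (Module)
import Data.Nat
open import Data.Nat using (ℕ; zero; suc; _+_; _^_)
open Data.Nat using () renaming (_*_ to _*ℕ_)
open import Data.Fin using (Fin)
open import Data.Product using (Σ; ∃; _×_; _,_)
open import Data.Unit.Polymorphic using (⊤)
open import Data.Vec.Functional using (foldr)
open import Relation.Nullary using (¬_)
open import Relation.Binary.PropositionalEquality using (_≡_)

gauss : ℕ → ℕ → ℕ → ℕ
gauss q n       zero    = 1
gauss q zero    (suc k) = 0
gauss q (suc n) (suc k) = gauss q n k + q ^ (suc k) *ℕ gauss q n (suc k)

record IsFiniteField {c ℓ} (F : CommutativeRing c ℓ) (q : ℕ) : Set (c ⊔ ℓ) where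
  open CommutativeRing F using (Carrier; _≈_; 0#; 1#; _*_)
  field
    0≉1      : ¬ (0# ≈ 1#)
    inverse  : ∀ x → ¬ (x ≈ 0#) → ∃ λ y → (x * y) ≈ 1#
    enum     : Fin q → Carrier
    enum-sur : ∀ x → ∃ λ j → enum j ≈ x
    enum-inj : ∀ i j → enum i ≈ enum j → i ≡ j

module Sub {c ℓ m ℓm} (F : CommutativeRing c ℓ) (M : Module F m ℓm) where
  open CommutativeRing F using (Carrier; _≈_; 0#)
  open Module M

  record Subspace : Set (c ⊔ lsuc (m ⊔ ℓm)) where
    field
      _∋_    : Carrierᴹ → Set (m ⊔ ℓm)
      resp   : ∀ {x y} → x ≈ᴹ y → _∋_ x → _∋_ y
      has0   : _∋_ 0ᴹ
      close+ : ∀ {x y} → _∋_ x → _∋_ y → _∋_ (x +ᴹ y)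
      close* : ∀ a {x} → _∋_ x → _∋_ (a *ₗ x)
  open Subspace public

  VSet : Set (m ⊔ lsuc (m ⊔ ℓm))
  VSet = Carrierᴹ → Set (m ⊔ ℓm)

  _≐_ : VSet → VSet → Set (m ⊔ ℓm)
  P ≐ Q = ∀ x → (P x → Q x) × (Q x → P x)

  _⊆_ : Subspace → Subspace → Set (m ⊔ ℓm)
  U ⊆ W = ∀ x → U ∋ x → W ∋ x

  _⊂_ : Subspace → Subspace → Set (m ⊔ ℓm)
  U ⊂ W = U ⊆ W × ∃ λ x → W ∋ x × ¬ (U ∋ x)

  _∩_ : Subspace → Subspace → VSet
  (U ∩ W) x = U ∋ x × W ∋ x

  _⊕_ : Subspace → Subspace → VSet
  (U ⊕ W) x = ∃ λ u → ∃ λ w → U ∋ u × W ∋ w × x ≈ᴹ (u +ᴹ w)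

  lincomb : ∀ {d} → (Fin d → Carrier) → (Fin d → Carrierᴹ) → Carrierᴹ
  lincomb cs b = foldr _+ᴹ_ 0ᴹ (λ i → cs i *ₗ b i)

  HasDim : VSet → ℕ → Set (c ⊔ ℓ ⊔ m ⊔ ℓm)
  HasDim P d = Σ (Fin d → Carrierᴹ) λ b →
      (∀ i → P (b i))
    × (∀ cs → lincomb cs b ≈ᴹ 0ᴹ → ∀ i → cs i ≈ 0#)
    × (∀ x → P x → ∃ λ cs → x ≈ᴹ lincomb cs b)

  dim_≡_ : Subspace → ℕ → Set (c ⊔ ℓ ⊔ m ⊔ ℓm)
  dim W ≡ d = HasDim (W ∋_) d

  VDim : ℕ → Set (c ⊔ ℓ ⊔ m ⊔ ℓm)
  VDim v = HasDim (λ _ → ⊤) v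

  Grass : Subspace → ℕ → Subspace → Set (c ⊔ ℓ ⊔ m ⊔ ℓm)
  Grass W j K = K ⊆ W × dim K ≡ j

  -- [V/U j]_q, via the correspondence K/U ↔ K (U ≤ K ≤ V):
  -- the set of K ≥ U with dim(K/U) = dim K - dim U = j.
  QuotGrass : Subspace → ℕ → Subspace → Set (c ⊔ ℓ ⊔ m ⊔ ℓm)
  QuotGrass U j K = U ⊆ K × ∃ λ d → dim U ≡ d × dim K ≡ (d + j)

  Covers : Subspace → Subspace → Subspace → Set (m ⊔ ℓm)
  Covers U₁ U₂ K = (U₁ ⊕ K) ≐ (U₂ ⊕ K)

  InJoin : Subspace → Subspace → Subspace → Subspace → Subspace → Set (m ⊔ ℓm)
  InJoin K₁ U₁ U₂ K₂ K = ((U₁ ∩ K) ≐ (K₁ ∋_)) × ((U₂ ⊕ K) ≐ (K₂ ∋_)) × Covers U₁ U₂ K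

  -- K ∈ B¹ *_{U₂/U₁} B²  where B¹ is a set of subspaces of U₁ and B² is a
  -- set of subspaces of V/U₂ given as the set of K₂ ≥ U₂ with K₂/U₂ ∈ B².
  InJoinSet : (Subspace → Set (c ⊔ ℓ ⊔ m ⊔ ℓm)) → Subspace → Subspace →
              (Subspace → Set (c ⊔ ℓ ⊔ m ⊔ ℓm)) → Subspace → Set (c ⊔ ℓ ⊔ lsuc (m ⊔ ℓm))
  InJoinSet B₁ U₁ U₂ B₂ K = ∃ λ K₁ → ∃ λ K₂ →
    B₁ K₁ × K₁ ⊆ U₁ × U₂ ⊆ K₂ × B₂ K₂ × InJoin K₁ U₁ U₂ K₂ K

  MaximalChain : ℕ → (ℕ → Subspace) → Set (m ⊔ ℓm)
  MaximalChain v U = (∀ x → U 0 ∋ x → x ≈ᴹ 0ᴹ)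
                   × (∀ x → U v ∋ x)
                   × (∀ j → suc j Data.Nat.≤ v → U j ⊂ U (suc j))

-- Choose x t ∈ U (t + 1) ∖ U t for every t < v.  These vectors form a basis in which U j is exactly
-- the set of vectors whose coordinates vanish from index j on.  Gaussian elimination gives every
-- subspace K an echelon basis whose leading indices ℓ₀ > ℓ₁ > ⋯ strictly decrease, and if p of
-- them are ≥ t then dim (U t ∩ K) = dim K − p and dim (U t + K) = t + p.  For dim K = k put
-- l = ℓₛ: then U l ∩ K has dimension k − s − 1, (U (l + 1) + K) / U (l + 1) has dimension s, and
-- K covers U (l + 1) / U l since its s-th echelon vector clears the l-th coordinate; so K lies in
-- the piece i = v − s − l − 1.  Conversely, in any piece these dimension counts force p = s at
-- l + 1 and p = s + 1 at l, which determines both dim K = k and l.  The counting formula follows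
-- separately from the q-Pascal recursion by induction.

module Submission where

open import Defs
open import Level using (_⊔_) renaming (suc to lsuc)
open import Algebra.Bundles using (CommutativeRing)
open import Algebra.Module.Bundles using (Module)
open import Data.Nat using (ℕ; suc; _+_; _*_; _∸_; _^_; _≤_; _<_)
open import Data.List using (map; upTo)
open import Data.Nat.ListAction using (sum)
open import Data.Product using (∃; _×_)
open import Relation.Binary.PropositionalEquality using (_≡_)

open import Algebra.Bundles using (CommutativeMonoid)
import Algebra.Properties.Ring
import Algebra.Properties.Group
import Algebra.Properties.CommutativeSemigroup
import Algebra.Properties.CommutativeMonoid.Sum
open import Data.Nat as ℕ using (zero; z≤n; s≤s)
import Data.Nat.Properties as ℕₚ
open import Data.Nat.ListAction.Properties using (sum-++)
open import Data.Nat.Solver using (module +-*-Solver)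
open +-*-Solver using (solve; _:=_; _:+_; _:*_; con)
open import Data.Fin as Fin using (Fin; zero; suc; toℕ; punchIn; punchOut; inject≤; _↑ˡ_; _↑ʳ_)
import Data.Fin.Properties as Finₚ
open import Data.List as List using (applyUpTo; [_])
open import Data.List.Properties using (map-upTo; applyUpTo-∷ʳ)
open import Data.Product using (_,_; proj₁; proj₂)
open import Data.Sum using (_⊎_; inj₁; inj₂)
open import Data.Empty using (⊥-elim)
open import Data.Unit.Polymorphic using (tt)
open import Data.Vec.Functional using (Vector; insertAt; removeAt; _++_)
open import Data.Vec.Functional.Properties using (insertAt-lookup; insertAt-punchIn; lookup-++ˡ; lookup-++ʳ)
open import Function using (_∘_)
open import Function.Definitions using (Injective)
open import Relation.Nullary using (¬_; ¬?; Dec; yes; no; _×-dec_)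
open import Relation.Binary using (Decidable; tri<; tri≈; tri>)
open import Relation.Binary.PropositionalEquality using (_≢_; refl; sym; trans; cong; cong₂; subst; subst₂; module ≡-Reasoning)
import Relation.Binary.Reasoning.Setoid as SetoidReasoning

-- Finite index sets

m∸n∸1≡m∸[1+n] : ∀ m n → m ∸ n ∸ 1 ≡ m ∸ suc n
m∸n∸1≡m∸[1+n] m n = trans (ℕₚ.∸-+-assoc m n 1) (cong (m ∸_) (ℕₚ.+-comm n 1))

m∸n≡1+m∸[1+n] : ∀ {m n} → n < m → m ∸ n ≡ suc (m ∸ suc n)
m∸n≡1+m∸[1+n] {suc m} {zero} _ = refl
m∸n≡1+m∸[1+n] {suc m} {suc n} (s≤s n<m) = m∸n≡1+m∸[1+n] n<m

argmax : ∀ {p n} (P : Fin n → Set p) → (∀ i → Dec (P i)) → (key : Fin n → ℕ) →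
         (∀ i → ¬ P i) ⊎ (∃ λ i → P i × (∀ j → P j → key j ≤ key i))
argmax {n = zero} P P? key = inj₁ (λ ())
argmax {n = suc n} P P? key with argmax (P ∘ suc) (P? ∘ suc) (key ∘ suc) | P? zero
... | inj₁ none | yes p₀ = inj₂ (zero , p₀ , λ { zero _ → ℕₚ.≤-refl ; (suc j) pj → ⊥-elim (none j pj) })
... | inj₁ none | no ¬p₀ = inj₁ (λ { zero → ¬p₀ ; (suc j) → none j })
... | inj₂ (i , pᵢ , max) | no ¬p₀ =
  inj₂ (suc i , pᵢ , λ { zero p₀ → ⊥-elim (¬p₀ p₀) ; (suc j) pj → max j pj })
... | inj₂ (i , pᵢ , max) | yes p₀ with key zero ℕ.≤? key (suc i)
...   | yes ≤ᵢ = inj₂ (suc i , pᵢ , λ { zero _ → ≤ᵢ ; (suc j) pj → max j pj })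
...   | no ≰ᵢ = inj₂ (zero , p₀ , λ { zero _ → ℕₚ.≤-refl
                                   ; (suc j) pj → ℕₚ.≤-trans (max j pj) (ℕₚ.<⇒≤ (ℕₚ.≰⇒> ≰ᵢ)) })

injective⇒surjective : ∀ {r v} {f : Fin r → Fin v} → v ≤ r → Injective _≡_ _≡_ f →
                       ∀ τ → ∃ λ i → f i ≡ τ
injective⇒surjective {r} {suc v} {f} v≤r f-inj τ with Finₚ.any? (λ i → f i Finₚ.≟ τ)
... | yes found = found
... | no missed = ⊥-elim (ℕₚ.<⇒≱ v≤r (Finₚ.injective⇒≤ g-inj))
  where
    f≢τ : ∀ i → ¬ τ ≡ f i
    f≢τ i e = missed (i , sym e)
    g : Fin r → Fin v
    g i = punchOut (f≢τ i)
    g-inj : Injective _≡_ _≡_ g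
    g-inj e = f-inj (Finₚ.punchOut-injective (f≢τ _) (f≢τ _) e)

StrictlyDecreasing : ∀ {r v} → (Fin r → Fin v) → Set
StrictlyDecreasing ℓ = ∀ i j → i Fin.< j → ℓ j Fin.< ℓ i

strictlyDecreasing⇒injective : ∀ {r v} {ℓ : Fin r → Fin v} → StrictlyDecreasing ℓ → Injective _≡_ _≡_ ℓ
strictlyDecreasing⇒injective {ℓ = ℓ} dec {i} {j} e with ℕₚ.<-cmp (toℕ i) (toℕ j)
... | tri< i<j _ _ = ⊥-elim (ℕₚ.<-irrefl (cong toℕ (sym e)) (dec i j i<j))
... | tri≈ _ i≡j _ = Finₚ.toℕ-injective i≡j
... | tri> _ _ j<i = ⊥-elim (ℕₚ.<-irrefl (cong toℕ e) (dec j i j<i))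

tail-decreasing : ∀ {r v} {ℓ : Fin (suc r) → Fin v} → StrictlyDecreasing ℓ → StrictlyDecreasing (ℓ ∘ suc)
tail-decreasing dec i j i<j = dec (suc i) (suc j) (s≤s i<j)

lead+index≤head : ∀ {r v} (ℓ : Fin (suc r) → Fin v) → StrictlyDecreasing ℓ →
                  ∀ j → toℕ (ℓ j) + toℕ j ≤ toℕ (ℓ zero)
lead+index≤head ℓ dec zero = ℕₚ.≤-reflexive (ℕₚ.+-identityʳ _)
lead+index≤head {suc r} ℓ dec (suc j) =
  subst (_≤ toℕ (ℓ zero)) (sym (ℕₚ.+-suc _ _))
    (ℕₚ.≤-trans (s≤s (lead+index≤head (ℓ ∘ suc) (tail-decreasing dec) j)) (dec zero (suc zero) (s≤s z≤n)))

lead+index< : ∀ {r v} (ℓ : Fin r → Fin v) → StrictlyDecreasing ℓ → ∀ j → toℕ (ℓ j) + toℕ j < v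
lead+index< {suc r} ℓ dec j = ℕₚ.≤-<-trans (lead+index≤head ℓ dec j) (Finₚ.toℕ<n (ℓ zero))

remaining≤lead : ∀ {r v} (ℓ : Fin r → Fin v) → StrictlyDecreasing ℓ → ∀ j → r ∸ suc (toℕ j) ≤ toℕ (ℓ j)
remaining≤lead {suc zero} ℓ dec zero = z≤n
remaining≤lead {suc (suc r)} ℓ dec zero =
  ℕₚ.≤-trans (s≤s (remaining≤lead (ℓ ∘ suc) (tail-decreasing dec) zero)) (dec zero (suc zero) (s≤s z≤n))
remaining≤lead {suc r} ℓ dec (suc j) = remaining≤lead (ℓ ∘ suc) (tail-decreasing dec) j

-- Since ℓ decreases, the entries ≥ t form an initial segment; p is its length.
SplitsAt : ∀ {r v} → (Fin r → Fin v) → ℕ → ℕ → Set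
SplitsAt {r} ℓ t p = p ≤ r × (∀ i → toℕ i < p → t ≤ toℕ (ℓ i)) × (∀ i → p ≤ toℕ i → toℕ (ℓ i) < t)

splitsAt-exists : ∀ {r v} (ℓ : Fin r → Fin v) → StrictlyDecreasing ℓ → ∀ t → ∃ (SplitsAt ℓ t)
splitsAt-exists {zero} ℓ dec t = 0 , z≤n , (λ ()) , (λ ())
splitsAt-exists {suc r} ℓ dec t with t ℕ.≤? toℕ (ℓ zero)
... | yes t≤ℓ₀ = suc p , s≤s p≤r , above , below
  where
    rest = splitsAt-exists (ℓ ∘ suc) (tail-decreasing dec) t
    p = proj₁ rest
    p≤r = proj₁ (proj₂ rest)
    above : ∀ i → toℕ i < suc p → t ≤ toℕ (ℓ i)
    above zero _ = t≤ℓ₀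
    above (suc i) i<p = proj₁ (proj₂ (proj₂ rest)) i (ℕₚ.≤-pred i<p)
    below : ∀ i → suc p ≤ toℕ i → toℕ (ℓ i) < t
    below zero ()
    below (suc i) p≤i = proj₂ (proj₂ (proj₂ rest)) i (ℕₚ.≤-pred p≤i)
... | no t≰ℓ₀ = 0 , z≤n , (λ i ()) , below
  where
    below : ∀ i → 0 ≤ toℕ i → toℕ (ℓ i) < t
    below zero _ = ℕₚ.≰⇒> t≰ℓ₀
    below (suc i) _ = ℕₚ.<-trans (dec zero (suc i) (s≤s z≤n)) (ℕₚ.≰⇒> t≰ℓ₀)

splitsAt-antitone : ∀ {r v} (ℓ : Fin r → Fin v) {t t′ p p′} → t ≤ t′ →
                    SplitsAt ℓ t p → SplitsAt ℓ t′ p′ → p′ ≤ p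
splitsAt-antitone {r} ℓ {t} {t′} {p} {p′} t≤t′ (_ , _ , below) (p′≤r , above′ , _) with p′ ℕ.≤? p
... | yes p′≤p = p′≤p
... | no p′≰p = ⊥-elim (ℕₚ.<⇒≱ (ℕₚ.<-≤-trans (below i (ℕₚ.≤-reflexive (sym i≡p))) t≤t′)
                                  (above′ i (subst (_< p′) (sym i≡p) p<p′)))
  where
    p<p′ = ℕₚ.≰⇒> p′≰p
    i : Fin r
    i = Fin.fromℕ< (ℕₚ.<-≤-trans p<p′ p′≤r)
    i≡p : toℕ i ≡ p
    i≡p = Finₚ.toℕ-fromℕ< (ℕₚ.<-≤-trans p<p′ p′≤r)

splitsAt-lead : ∀ {r v} (ℓ : Fin r → Fin v) → StrictlyDecreasing ℓ →
                ∀ ι → SplitsAt ℓ (suc (toℕ (ℓ ι))) (toℕ ι)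
splitsAt-lead ℓ dec ι = ℕₚ.<⇒≤ (Finₚ.toℕ<n ι) , (λ i i<ι → dec i ι i<ι) , below
  where
    below : ∀ i → toℕ ι ≤ toℕ i → toℕ (ℓ i) < suc (toℕ (ℓ ι))
    below i ι≤i with ℕₚ.m≤n⇒m<n∨m≡n ι≤i
    ... | inj₁ ι<i = ℕₚ.m<n⇒m<1+n (dec ι i ι<i)
    ... | inj₂ ι≡i = s≤s (ℕₚ.≤-reflexive (cong (toℕ ∘ ℓ) (Finₚ.toℕ-injective (sym ι≡i))))

splitsAt-lead-suc : ∀ {r v} (ℓ : Fin r → Fin v) → StrictlyDecreasing ℓ →
                    ∀ ι → SplitsAt ℓ (toℕ (ℓ ι)) (suc (toℕ ι))
splitsAt-lead-suc ℓ dec ι = Finₚ.toℕ<n ι , above , (λ i ι<i → dec ι i ι<i)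
  where
    above : ∀ i → toℕ i < suc (toℕ ι) → toℕ (ℓ ι) ≤ toℕ (ℓ i)
    above i i≤ι with ℕₚ.m≤n⇒m<n∨m≡n (ℕₚ.≤-pred i≤ι)
    ... | inj₁ i<ι = ℕₚ.<⇒≤ (dec i ι i<ι)
    ... | inj₂ i≡ι = ℕₚ.≤-reflexive (cong (toℕ ∘ ℓ) (Finₚ.toℕ-injective (sym i≡ι)))

raise∸ : ∀ {r} p → Fin (r ∸ p) → Fin r
raise∸ zero i = i
raise∸ {suc r} (suc p) i = suc (raise∸ p i)

toℕ-raise∸ : ∀ {r} p i → toℕ (raise∸ {r} p i) ≡ p + toℕ i
toℕ-raise∸ zero i = refl
toℕ-raise∸ {suc r} (suc p) i = cong suc (toℕ-raise∸ p i)

raise∸-injective : ∀ {r} p → Injective _≡_ _≡_ (raise∸ {r} p)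
raise∸-injective p {i} {j} e =
  Finₚ.toℕ-injective (ℕₚ.+-cancelˡ-≡ p _ _ (trans (sym (toℕ-raise∸ p i)) (trans (cong toℕ e) (toℕ-raise∸ p j))))

↑-elim : ∀ {a m n} {P : Fin (m + n) → Set a} → (∀ i → P (i ↑ˡ n)) → (∀ j → P (m ↑ʳ j)) → ∀ i → P i
↑-elim {m = zero} left right i = right i
↑-elim {m = suc m} left right zero = left zero
↑-elim {m = suc m} {P = P} left right (suc i) = ↑-elim {m = m} {P = P ∘ suc} (left ∘ suc) right i

-- Finite fields and linear algebra

module _ {a ℓ} (M : CommutativeMonoid a ℓ) where
  open CommutativeMonoid M using (Carrier; _≈_; ε; ∙-congˡ; identityʳ) renaming (trans to ≈-trans)
  open Algebra.Properties.CommutativeMonoid.Sum M using (sum-cong-≋; sum-replicate-zero; sum-remove) renaming (sum to ∑)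

  sum-≈ε : ∀ {n} {f : Vector Carrier n} → (∀ i → f i ≈ ε) → ∑ f ≈ ε
  sum-≈ε {n} f≈ε = ≈-trans (sum-cong-≋ f≈ε) (sum-replicate-zero n)

  sum-≈single : ∀ {n} (f : Vector Carrier n) i → (∀ j → j ≢ i → f j ≈ ε) → ∑ f ≈ f i
  sum-≈single {suc n} f i others≈ε =
    ≈-trans (sum-remove f) (≈-trans (∙-congˡ (sum-≈ε (λ j → others≈ε (punchIn i j) (Finₚ.punchInᵢ≢i i j))))
                                    (identityʳ (f i)))

module Field {c ℓ} (F : CommutativeRing c ℓ) {q} (FF : IsFiniteField F q) where
  open CommutativeRing F renaming (sym to ≈-sym; trans to ≈-trans; _+_ to _+F_; _*_ to _*F_; -_ to -F_)
  open IsFiniteField FF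
  open Algebra.Properties.Ring ring using (-‿distribˡ-*; -1*x≈-x)
  open Algebra.Properties.Group +-group using (x∙y⁻¹≈ε⇒x≈y)
  open SetoidReasoning setoid

  _≈?_ : Decidable _≈_
  x ≈? y with enum-sur x | enum-sur y
  ... | i , eᵢ≈x | j , eⱼ≈y with i Finₚ.≟ j
  ... | yes refl = yes (≈-trans (≈-sym eᵢ≈x) eⱼ≈y)
  ... | no i≢j = no (λ x≈y → i≢j (enum-inj i j (≈-trans eᵢ≈x (≈-trans x≈y (≈-sym eⱼ≈y)))))

  ≈-stable : ∀ {x y} → ¬ ¬ (x ≈ y) → x ≈ y
  ≈-stable {x} {y} ¬¬x≈y with x ≈? y
  ... | yes x≈y = x≈y
  ... | no x≉y = ⊥-elim (¬¬x≈y x≉y)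

  inv : (x : Carrier) → ¬ x ≈ 0# → Carrier
  inv x x≉0 = proj₁ (inverse x x≉0)

  *-inverseʳ : ∀ x x≉0 → x *F inv x x≉0 ≈ 1#
  *-inverseʳ x x≉0 = proj₂ (inverse x x≉0)

  inv-nonzero : ∀ x x≉0 → ¬ inv x x≉0 ≈ 0#
  inv-nonzero x x≉0 x⁻¹≈0 = 0≉1 (≈-trans (≈-sym (≈-trans (*-congˡ x⁻¹≈0) (zeroʳ x))) (*-inverseʳ x x≉0))

  1≉0 : ¬ 1# ≈ 0#
  1≉0 1≈0 = 0≉1 (≈-sym 1≈0)

  *-nonzero : ∀ {x y} → ¬ x ≈ 0# → ¬ y ≈ 0# → ¬ x *F y ≈ 0#
  *-nonzero {x} {y} x≉0 y≉0 xy≈0 = y≉0 (begin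
      y                ≈⟨ *-identityˡ y ⟨
      1# *F y          ≈⟨ *-congʳ (≈-trans (*-comm _ _) (*-inverseʳ x x≉0)) ⟨
      (x⁻¹ *F x) *F y  ≈⟨ *-assoc x⁻¹ x y ⟩
      x⁻¹ *F (x *F y)  ≈⟨ *-congˡ xy≈0 ⟩
      x⁻¹ *F 0#        ≈⟨ zeroʳ x⁻¹ ⟩
      0#               ∎)
    where x⁻¹ = inv x x≉0

  -‿nonzero : ∀ {x} → ¬ x ≈ 0# → ¬ -F x ≈ 0#
  -‿nonzero {x} x≉0 -x≈0 = x≉0 (≈-trans (≈-sym (≈-trans (+-congˡ -x≈0) (+-identityʳ x))) (-‿inverseʳ x))

  x-[x/d]*d≈0 : ∀ x d (d≉0 : ¬ d ≈ 0#) → x +F (-F (x *F inv d d≉0)) *F d ≈ 0#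
  x-[x/d]*d≈0 x d d≉0 = begin
      x +F (-F (x *F d⁻¹)) *F d  ≈⟨ +-congˡ (-‿distribˡ-* (x *F d⁻¹) d) ⟨
      x +F -F ((x *F d⁻¹) *F d)  ≈⟨ +-congˡ (-‿cong x/d*d≈x) ⟩
      x +F -F x                  ≈⟨ -‿inverseʳ x ⟩
      0#                         ∎
    where
      d⁻¹ = inv d d≉0
      x/d*d≈x : (x *F d⁻¹) *F d ≈ x
      x/d*d≈x = begin
        (x *F d⁻¹) *F d  ≈⟨ *-assoc x d⁻¹ d ⟩
        x *F (d⁻¹ *F d)  ≈⟨ *-congˡ (≈-trans (*-comm d⁻¹ d) (*-inverseʳ d d≉0)) ⟩
        x *F 1#          ≈⟨ *-identityʳ x ⟩
        x                ∎

  x+-1*y≈0⇒x≈y : ∀ x y → x +F (-F 1#) *F y ≈ 0# → x ≈ y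
  x+-1*y≈0⇒x≈y x y e = x∙y⁻¹≈ε⇒x≈y x y (≈-trans (+-congˡ (≈-sym (-1*x≈-x y))) e)

module LinearAlgebra {c ℓ m ℓm} (F : CommutativeRing c ℓ) {q} (FF : IsFiniteField F q) (M : Module F m ℓm) where
  open CommutativeRing F using (Carrier; _≈_; 0#; 1#; setoid; +-commutativeMonoid)
    renaming (_+_ to _+F_; _*_ to _*F_; -_ to -F_)
  module R = CommutativeRing F
  open Field F FF public
  open Module M
  open Sub F M
  module ΣF = Algebra.Properties.CommutativeMonoid.Sum +-commutativeMonoid
  -- lincomb cs f is definitionally ΣM.sum (λ i → cs i *ₗ f i).
  module ΣM = Algebra.Properties.CommutativeMonoid.Sum +ᴹ-commutativeMonoid
  open Algebra.Properties.CommutativeSemigroup (CommutativeMonoid.commutativeSemigroup +ᴹ-commutativeMonoid)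
    using () renaming (interchange to +ᴹ-interchange)
  module ≈ᴹ-Reasoning = SetoidReasoning ≈ᴹ-setoid

  x+-1x≈0 : ∀ x → x +ᴹ ((-F 1#) *ₗ x) ≈ᴹ 0ᴹ
  x+-1x≈0 x = begin
      x +ᴹ ((-F 1#) *ₗ x)          ≈⟨ +ᴹ-congʳ (*ₗ-identityˡ x) ⟨
      (1# *ₗ x) +ᴹ ((-F 1#) *ₗ x)  ≈⟨ *ₗ-distribʳ x 1# (-F 1#) ⟨
      (1# +F (-F 1#)) *ₗ x         ≈⟨ *ₗ-congʳ (R.-‿inverseʳ 1#) ⟩
      0# *ₗ x                      ≈⟨ *ₗ-zeroˡ x ⟩
      0ᴹ                           ∎
    where open ≈ᴹ-Reasoning

  [x+y]-y≈x : ∀ x y → (x +ᴹ y) +ᴹ ((-F 1#) *ₗ y) ≈ᴹ x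
  [x+y]-y≈x x y = begin
      (x +ᴹ y) +ᴹ ((-F 1#) *ₗ y)  ≈⟨ +ᴹ-assoc x y _ ⟩
      x +ᴹ (y +ᴹ ((-F 1#) *ₗ y))  ≈⟨ +ᴹ-congˡ (x+-1x≈0 y) ⟩
      x +ᴹ 0ᴹ                     ≈⟨ +ᴹ-identityʳ x ⟩
      x                           ∎
    where open ≈ᴹ-Reasoning

  [y+x]-y≈x : ∀ x y → (y +ᴹ x) +ᴹ ((-F 1#) *ₗ y) ≈ᴹ x
  [y+x]-y≈x x y = ≈ᴹ-trans (+ᴹ-congʳ (+ᴹ-comm y x)) ([x+y]-y≈x x y)

  x≈[x-y]+y : ∀ x y → x ≈ᴹ (x +ᴹ ((-F 1#) *ₗ y)) +ᴹ y
  x≈[x-y]+y x y = begin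
      x                             ≈⟨ +ᴹ-identityʳ x ⟨
      x +ᴹ 0ᴹ                       ≈⟨ +ᴹ-congˡ (≈ᴹ-trans (+ᴹ-comm _ y) (x+-1x≈0 y)) ⟨
      x +ᴹ (((-F 1#) *ₗ y) +ᴹ y)    ≈⟨ +ᴹ-assoc x _ y ⟨
      (x +ᴹ ((-F 1#) *ₗ y)) +ᴹ y    ∎
    where open ≈ᴹ-Reasoning

  -az+az≈0 : ∀ a z → ((-F a) *ₗ z) +ᴹ (a *ₗ z) ≈ᴹ 0ᴹ
  -az+az≈0 a z = begin
      ((-F a) *ₗ z) +ᴹ (a *ₗ z)  ≈⟨ *ₗ-distribʳ z (-F a) a ⟨
      (-F a +F a) *ₗ z           ≈⟨ *ₗ-congʳ (R.-‿inverseˡ a) ⟩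
      0# *ₗ z                    ≈⟨ *ₗ-zeroˡ z ⟩
      0ᴹ                         ∎
    where open ≈ᴹ-Reasoning

  [x-az]+az≈x : ∀ x a z → (x +ᴹ ((-F a) *ₗ z)) +ᴹ (a *ₗ z) ≈ᴹ x
  [x-az]+az≈x x a z = begin
      (x +ᴹ ((-F a) *ₗ z)) +ᴹ (a *ₗ z)  ≈⟨ +ᴹ-assoc x _ _ ⟩
      x +ᴹ (((-F a) *ₗ z) +ᴹ (a *ₗ z))  ≈⟨ +ᴹ-congˡ (-az+az≈0 a z) ⟩
      x +ᴹ 0ᴹ                           ≈⟨ +ᴹ-identityʳ x ⟩
      x                                 ∎
    where open ≈ᴹ-Reasoning

  [x-az]+[y+az]≈x+y : ∀ x y a z → (x +ᴹ ((-F a) *ₗ z)) +ᴹ (y +ᴹ (a *ₗ z)) ≈ᴹ x +ᴹ y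
  [x-az]+[y+az]≈x+y x y a z = begin
      (x +ᴹ ((-F a) *ₗ z)) +ᴹ (y +ᴹ (a *ₗ z))  ≈⟨ +ᴹ-interchange x _ y _ ⟩
      (x +ᴹ y) +ᴹ (((-F a) *ₗ z) +ᴹ (a *ₗ z))  ≈⟨ +ᴹ-congˡ (-az+az≈0 a z) ⟩
      (x +ᴹ y) +ᴹ 0ᴹ                           ≈⟨ +ᴹ-identityʳ _ ⟩
      x +ᴹ y                                   ∎
    where open ≈ᴹ-Reasoning

  lincomb-cong : ∀ {n} {cs ds : Fin n → Carrier} {f g : Fin n → Carrierᴹ} →
                 (∀ i → cs i ≈ ds i) → (∀ i → f i ≈ᴹ g i) → lincomb cs f ≈ᴹ lincomb ds g
  lincomb-cong cs≈ds f≈g = ΣM.sum-cong-≋ (λ i → *ₗ-cong (cs≈ds i) (f≈g i))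

  lincomb-congˡ : ∀ {n} {cs ds : Fin n → Carrier} {f : Fin n → Carrierᴹ} →
                  (∀ i → cs i ≈ ds i) → lincomb cs f ≈ᴹ lincomb ds f
  lincomb-congˡ cs≈ds = lincomb-cong cs≈ds (λ _ → ≈ᴹ-refl)

  lincomb-zeroˡ : ∀ {n} {cs : Fin n → Carrier} {f : Fin n → Carrierᴹ} →
                  (∀ i → cs i ≈ 0#) → lincomb cs f ≈ᴹ 0ᴹ
  lincomb-zeroˡ {f = f} cs≈0 = sum-≈ε +ᴹ-commutativeMonoid (λ i → ≈ᴹ-trans (*ₗ-congʳ (cs≈0 i)) (*ₗ-zeroˡ (f i)))

  lincomb-zeroʳ : ∀ {n} {cs : Fin n → Carrier} {f : Fin n → Carrierᴹ} →
                  (∀ i → f i ≈ᴹ 0ᴹ) → lincomb cs f ≈ᴹ 0ᴹ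
  lincomb-zeroʳ {cs = cs} f≈0 = sum-≈ε +ᴹ-commutativeMonoid (λ i → ≈ᴹ-trans (*ₗ-congˡ (f≈0 i)) (*ₗ-zeroʳ (cs i)))

  lincomb-distribˡ : ∀ {n} (cs ds : Fin n → Carrier) (f : Fin n → Carrierᴹ) →
                     lincomb (λ i → cs i +F ds i) f ≈ᴹ lincomb cs f +ᴹ lincomb ds f
  lincomb-distribˡ cs ds f =
    ≈ᴹ-trans (ΣM.sum-cong-≋ (λ i → *ₗ-distribʳ (f i) (cs i) (ds i)))
             (ΣM.∑-distrib-+ (λ i → cs i *ₗ f i) (λ i → ds i *ₗ f i))

  lincomb-distribʳ : ∀ {n} (cs : Fin n → Carrier) (f g : Fin n → Carrierᴹ) →
                     lincomb cs (λ i → f i +ᴹ g i) ≈ᴹ lincomb cs f +ᴹ lincomb cs g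
  lincomb-distribʳ cs f g =
    ≈ᴹ-trans (ΣM.sum-cong-≋ (λ i → *ₗ-distribˡ (cs i) (f i) (g i)))
             (ΣM.∑-distrib-+ (λ i → cs i *ₗ f i) (λ i → cs i *ₗ g i))

  lincomb-*ₗ : ∀ {n} a (cs : Fin n → Carrier) (f : Fin n → Carrierᴹ) →
               lincomb (λ i → a *F cs i) f ≈ᴹ a *ₗ lincomb cs f
  lincomb-*ₗ {zero} a cs f = ≈ᴹ-sym (*ₗ-zeroʳ a)
  lincomb-*ₗ {suc n} a cs f = begin
      ((a *F cs zero) *ₗ f zero) +ᴹ lincomb (λ i → a *F cs (suc i)) (f ∘ suc)
        ≈⟨ +ᴹ-cong (*ₗ-assoc a (cs zero) (f zero)) (lincomb-*ₗ a (cs ∘ suc) (f ∘ suc)) ⟩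
      (a *ₗ (cs zero *ₗ f zero)) +ᴹ (a *ₗ lincomb (cs ∘ suc) (f ∘ suc))
        ≈⟨ *ₗ-distribˡ a _ _ ⟨
      a *ₗ lincomb cs f ∎
    where open ≈ᴹ-Reasoning

  lincomb-multiples : ∀ {n} (cs as : Fin n → Carrier) z →
                      lincomb cs (λ i → as i *ₗ z) ≈ᴹ ΣF.sum (λ i → cs i *F as i) *ₗ z
  lincomb-multiples {zero} cs as z = ≈ᴹ-sym (*ₗ-zeroˡ z)
  lincomb-multiples {suc n} cs as z = begin
      (cs zero *ₗ (as zero *ₗ z)) +ᴹ lincomb (cs ∘ suc) (λ i → as (suc i) *ₗ z)
        ≈⟨ +ᴹ-cong (≈ᴹ-sym (*ₗ-assoc (cs zero) (as zero) z)) (lincomb-multiples (cs ∘ suc) (as ∘ suc) z) ⟩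
      ((cs zero *F as zero) *ₗ z) +ᴹ (ΣF.sum (λ i → cs (suc i) *F as (suc i)) *ₗ z)
        ≈⟨ *ₗ-distribʳ z _ _ ⟨
      ΣF.sum (λ i → cs i *F as i) *ₗ z ∎
    where open ≈ᴹ-Reasoning

  lincomb-remove : ∀ {n} (p : Fin (suc n)) (cs : Fin (suc n) → Carrier) (f : Fin (suc n) → Carrierᴹ) →
                   lincomb cs f ≈ᴹ (cs p *ₗ f p) +ᴹ lincomb (removeAt cs p) (removeAt f p)
  lincomb-remove p cs f = ΣM.sum-remove {i = p} (λ i → cs i *ₗ f i)

  lincomb-insertAt : ∀ {n} (p : Fin (suc n)) a (cs : Fin n → Carrier) (f : Fin (suc n) → Carrierᴹ) →
                     lincomb (insertAt cs p a) f ≈ᴹ (a *ₗ f p) +ᴹ lincomb cs (removeAt f p)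
  lincomb-insertAt p a cs f = ≈ᴹ-trans (lincomb-remove p (insertAt cs p a) f)
    (+ᴹ-cong (*ₗ-congʳ (R.reflexive (insertAt-lookup cs p a)))
             (lincomb-congˡ (λ i → R.reflexive (insertAt-punchIn cs p a i))))

  δ : ∀ {n} → Fin n → Fin n → Carrier
  δ {suc n} t = insertAt (λ _ → 0#) t 1#

  δ-diag : ∀ {n} (t : Fin n) → δ t t ≈ 1#
  δ-diag {suc n} t = R.reflexive (insertAt-lookup _ t 1#)

  δ-offdiag : ∀ {n} {t t′ : Fin n} → t ≢ t′ → δ t t′ ≈ 0#
  δ-offdiag {suc n} {t} t≢t′ =
    R.reflexive (subst (λ z → δ t z ≡ 0#) (Finₚ.punchIn-punchOut t≢t′) (insertAt-punchIn _ t 1# (punchOut t≢t′)))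

  lincomb-δ : ∀ {n} (t : Fin n) (f : Fin n → Carrierᴹ) → lincomb (δ t) f ≈ᴹ f t
  lincomb-δ {suc n} t f = begin
      lincomb (δ t) f                                   ≈⟨ lincomb-insertAt t 1# _ f ⟩
      (1# *ₗ f t) +ᴹ lincomb (λ _ → 0#) (removeAt f t)  ≈⟨ +ᴹ-cong (*ₗ-identityˡ (f t)) (lincomb-zeroˡ {f = removeAt f t} λ _ → R.refl) ⟩
      f t +ᴹ 0ᴹ                                         ≈⟨ +ᴹ-identityʳ _ ⟩
      f t                                               ∎
    where open ≈ᴹ-Reasoning

  lincomb-↑ : ∀ {m n} (cs : Fin (m + n) → Carrier) (f : Fin (m + n) → Carrierᴹ) →
              lincomb cs f ≈ᴹ lincomb (cs ∘ (_↑ˡ n)) (f ∘ (_↑ˡ n)) +ᴹ lincomb (cs ∘ (m ↑ʳ_)) (f ∘ (m ↑ʳ_))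
  lincomb-↑ {zero} cs f = ≈ᴹ-sym (+ᴹ-identityˡ _)
  lincomb-↑ {suc m} cs f = ≈ᴹ-trans (+ᴹ-congˡ (lincomb-↑ {m} (cs ∘ suc) (f ∘ suc))) (≈ᴹ-sym (+ᴹ-assoc _ _ _))

  lincomb-++ : ∀ {m n} (cs : Fin m → Carrier) (ds : Fin n → Carrier) (f : Fin m → Carrierᴹ) (g : Fin n → Carrierᴹ) →
               lincomb (cs ++ ds) (f ++ g) ≈ᴹ lincomb cs f +ᴹ lincomb ds g
  lincomb-++ {m} cs ds f g = ≈ᴹ-trans (lincomb-↑ {m} (cs ++ ds) (f ++ g))
    (+ᴹ-cong (lincomb-cong (λ i → R.reflexive (lookup-++ˡ cs ds i)) (λ i → ≈ᴹ-reflexive (lookup-++ˡ f g i)))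
             (lincomb-cong (λ j → R.reflexive (lookup-++ʳ cs ds j)) (λ j → ≈ᴹ-reflexive (lookup-++ʳ f g j))))

  lincomb-prefix+suffix : ∀ {r} p (p≤r : p ≤ r) (cs : Fin r → Carrier) (f : Fin r → Carrierᴹ) →
                    lincomb cs f ≈ᴹ lincomb (cs ∘ (λ i → inject≤ i p≤r)) (f ∘ (λ i → inject≤ i p≤r))
                                    +ᴹ lincomb (cs ∘ raise∸ p) (f ∘ raise∸ p)
  lincomb-prefix+suffix zero p≤r cs f = ≈ᴹ-sym (+ᴹ-identityˡ _)
  lincomb-prefix+suffix {suc r} (suc p) p≤r cs f =
    ≈ᴹ-trans (+ᴹ-congˡ (lincomb-prefix+suffix p (ℕₚ.≤-pred p≤r) (cs ∘ suc) (f ∘ suc))) (≈ᴹ-sym (+ᴹ-assoc _ _ _))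

  Independent : ∀ {n} → (Fin n → Carrierᴹ) → Set (c ⊔ ℓ ⊔ ℓm)
  Independent f = ∀ cs → lincomb cs f ≈ᴹ 0ᴹ → ∀ i → cs i ≈ 0#

  Span : ∀ {n} → (Fin n → Carrierᴹ) → Carrierᴹ → Set (c ⊔ ℓm)
  Span f y = ∃ λ cs → y ≈ᴹ lincomb cs f

  span-resp : ∀ {n} {f : Fin n → Carrierᴹ} {x y} → x ≈ᴹ y → Span f x → Span f y
  span-resp x≈y (cs , x≈) = cs , ≈ᴹ-trans (≈ᴹ-sym x≈y) x≈

  span-0 : ∀ {n} {f : Fin n → Carrierᴹ} → Span f 0ᴹ
  span-0 {f = f} = (λ _ → 0#) , ≈ᴹ-sym (lincomb-zeroˡ {f = f} (λ _ → R.refl))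

  span-+ : ∀ {n} {f : Fin n → Carrierᴹ} {x y} → Span f x → Span f y → Span f (x +ᴹ y)
  span-+ {f = f} (cs , x≈) (ds , y≈) =
    (λ i → cs i +F ds i) , ≈ᴹ-trans (+ᴹ-cong x≈ y≈) (≈ᴹ-sym (lincomb-distribˡ cs ds f))

  span-*ₗ : ∀ {n} {f : Fin n → Carrierᴹ} {x} a → Span f x → Span f (a *ₗ x)
  span-*ₗ {f = f} a (cs , x≈) = (λ i → a *F cs i) , ≈ᴹ-trans (*ₗ-congˡ x≈) (≈ᴹ-sym (lincomb-*ₗ a cs f))

  span-generator : ∀ {n} (f : Fin n → Carrierᴹ) i → Span f (f i)
  span-generator f i = δ i , ≈ᴹ-sym (lincomb-δ i f)

  span-lincomb : ∀ {n k} {f : Fin n → Carrierᴹ} {g : Fin k → Carrierᴹ} (cs : Fin k → Carrier) →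
                 (∀ i → Span f (g i)) → Span f (lincomb cs g)
  span-lincomb {k = zero} cs g∈ = span-0
  span-lincomb {k = suc k} cs g∈ = span-+ (span-*ₗ (cs zero) (g∈ zero)) (span-lincomb (cs ∘ suc) (g∈ ∘ suc))

  span-trans : ∀ {n k} {f : Fin n → Carrierᴹ} {g : Fin k → Carrierᴹ} {y} →
               (∀ i → Span f (g i)) → Span g y → Span f y
  span-trans g∈ (cs , y≈) = span-resp (≈ᴹ-sym y≈) (span-lincomb cs g∈)

  span-insert₀ : ∀ {n} {f : Fin n → Carrierᴹ} {y} a → Span f y → Span (insertAt f zero a) y
  span-insert₀ a (cs , y≈) =
    insertAt cs zero 0# , ≈ᴹ-trans y≈ (≈ᴹ-trans (≈ᴹ-sym (+ᴹ-identityˡ _)) (+ᴹ-congʳ (≈ᴹ-sym (*ₗ-zeroˡ a))))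

  ∋-lincomb : (W : Subspace) → ∀ {n} {f : Fin n → Carrierᴹ} (cs : Fin n → Carrier) →
              (∀ i → W ∋ f i) → W ∋ lincomb cs f
  ∋-lincomb W {zero} cs f∈ = has0 W
  ∋-lincomb W {suc n} cs f∈ = close+ W (close* W (cs zero) (f∈ zero)) (∋-lincomb W (cs ∘ suc) (f∈ ∘ suc))

  ∋-lincomb-terms : (W : Subspace) → ∀ {n} {f : Fin n → Carrierᴹ} (cs : Fin n → Carrier) →
                    (∀ i → W ∋ (cs i *ₗ f i)) → W ∋ lincomb cs f
  ∋-lincomb-terms W {zero} cs terms∈ = has0 W
  ∋-lincomb-terms W {suc n} cs terms∈ = close+ W (terms∈ zero) (∋-lincomb-terms W (cs ∘ suc) (terms∈ ∘ suc))

  ∋-sub : (W : Subspace) → ∀ {x y} → W ∋ x → W ∋ y → W ∋ (x +ᴹ ((-F 1#) *ₗ y))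
  ∋-sub W x∈ y∈ = close+ W x∈ (close* W _ y∈)

  ∋-zero*ₗ : (W : Subspace) → ∀ {a z} → a ≈ 0# → W ∋ (a *ₗ z)
  ∋-zero*ₗ W {a} {z} a≈0 = resp W (≈ᴹ-sym (≈ᴹ-trans (*ₗ-congʳ a≈0) (*ₗ-zeroˡ z))) (has0 W)

  ∋-*ₗ⁻¹ : (W : Subspace) → ∀ {a z} → ¬ a ≈ 0# → W ∋ (a *ₗ z) → W ∋ z
  ∋-*ₗ⁻¹ W {a} {z} a≉0 az∈ = resp W a⁻¹az≈z (close* W a⁻¹ az∈)
    where
      a⁻¹ = inv a a≉0
      a⁻¹az≈z : a⁻¹ *ₗ (a *ₗ z) ≈ᴹ z
      a⁻¹az≈z = begin
          a⁻¹ *ₗ (a *ₗ z)  ≈⟨ *ₗ-assoc a⁻¹ a z ⟨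
          (a⁻¹ *F a) *ₗ z  ≈⟨ *ₗ-congʳ (R.trans (R.*-comm a⁻¹ a) (*-inverseʳ a a≉0)) ⟩
          1# *ₗ z          ≈⟨ *ₗ-identityˡ z ⟩
          z                ∎
        where open ≈ᴹ-Reasoning

  _∩ˢ_ : Subspace → Subspace → Subspace
  A ∩ˢ B = record
    { _∋_ = A ∩ B
    ; resp = λ x≈y (x∈A , x∈B) → resp A x≈y x∈A , resp B x≈y x∈B
    ; has0 = has0 A , has0 B
    ; close+ = λ (x∈A , x∈B) (y∈A , y∈B) → close+ A x∈A y∈A , close+ B x∈B y∈B
    ; close* = λ a (x∈A , x∈B) → close* A a x∈A , close* B a x∈B
    }

  _+ˢ_ : Subspace → Subspace → Subspace
  A +ˢ B = record
    { _∋_ = A ⊕ B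
    ; resp = λ { x≈y (a , b , a∈ , b∈ , x≈) → a , b , a∈ , b∈ , ≈ᴹ-trans (≈ᴹ-sym x≈y) x≈ }
    ; has0 = 0ᴹ , 0ᴹ , has0 A , has0 B , ≈ᴹ-sym (+ᴹ-identityˡ 0ᴹ)
    ; close+ = λ { (a , b , a∈ , b∈ , x≈) (a′ , b′ , a′∈ , b′∈ , y≈) →
                   a +ᴹ a′ , b +ᴹ b′ , close+ A a∈ a′∈ , close+ B b∈ b′∈ ,
                   ≈ᴹ-trans (+ᴹ-cong x≈ y≈) (+ᴹ-interchange a b a′ b′) }
    ; close* = λ { k (a , b , a∈ , b∈ , x≈) → k *ₗ a , k *ₗ b , close* A k a∈ , close* B k b∈ ,
                   ≈ᴹ-trans (*ₗ-congˡ x≈) (*ₗ-distribˡ k a b) }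
    }

  ≐-sym : ∀ {P Q : VSet} → P ≐ Q → Q ≐ P
  ≐-sym P≐Q y = proj₂ (P≐Q y) , proj₁ (P≐Q y)

  HasDim-resp : ∀ {P Q : VSet} {d} → P ≐ Q → HasDim P d → HasDim Q d
  HasDim-resp P≐Q (b , b∈ , indep , spans) =
    b , (λ i → proj₁ (P≐Q (b i)) (b∈ i)) , indep , (λ y y∈ → spans y (proj₂ (P≐Q y) y∈))

  independent-zeros⇒empty : ∀ {n} (f : Fin n → Carrierᴹ) → (∀ i → f i ≈ᴹ 0ᴹ) → Independent f → 0 ≡ n
  independent-zeros⇒empty {zero} f f≈0 indep = refl
  independent-zeros⇒empty {suc n} f f≈0 indep =
    ⊥-elim (1≉0 (indep (λ _ → 1#) (lincomb-zeroʳ {cs = λ _ → 1#} f≈0) zero))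

  -- If each f t lies outside W t but every earlier f i inside it, the last nonzero coefficient
  -- of a vanishing combination would put f t into W t.
  chain⇒independent : ∀ {n} (f : Fin n → Carrierᴹ) (W : Fin n → Subspace) →
                      (∀ t i → i Fin.< t → W t ∋ f i) → (∀ t → ¬ (W t ∋ f t)) → Independent f
  chain⇒independent {zero} f W inside outside cs _ ()
  chain⇒independent {suc n} f W inside outside cs ∑≈0
    with argmax (λ i → ¬ cs i ≈ 0#) (λ i → ¬? (cs i ≈? 0#)) toℕ
  ... | inj₁ all≈0 = λ i → ≈-stable (all≈0 i)
  ... | inj₂ (t , cₜ≉0 , last) = ⊥-elim (outside t (∋-*ₗ⁻¹ (W t) cₜ≉0 cₜfₜ∈))
    where
      rest = lincomb (removeAt cs t) (removeAt f t)
      term∈ : ∀ i → W t ∋ (cs (punchIn t i) *ₗ f (punchIn t i))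
      term∈ i with cs (punchIn t i) ≈? 0#
      ... | yes c≈0 = ∋-zero*ₗ (W t) c≈0
      ... | no c≉0 = close* (W t) _ (inside t (punchIn t i)
                       (ℕₚ.≤∧≢⇒< (last (punchIn t i) c≉0) (Finₚ.punchInᵢ≢i t i ∘ Finₚ.toℕ-injective)))
      cₜfₜ+rest≈0 : (cs t *ₗ f t) +ᴹ rest ≈ᴹ 0ᴹ
      cₜfₜ+rest≈0 = ≈ᴹ-trans (≈ᴹ-sym (lincomb-remove t cs f)) ∑≈0
      cₜfₜ∈ : W t ∋ (cs t *ₗ f t)
      cₜfₜ∈ = resp (W t) ([x+y]-y≈x _ rest)
                (∋-sub (W t) (resp (W t) (≈ᴹ-sym cₜfₜ+rest≈0) (has0 (W t))) (∋-lincomb-terms (W t) _ term∈))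

  module Coordinates {v} (B : Fin v → Carrierᴹ) (B-independent : Independent B) (B-spans : ∀ y → Span B y) where

    coord : Carrierᴹ → Fin v → Carrier
    coord y = proj₁ (B-spans y)

    coord-spec : ∀ y → y ≈ᴹ lincomb (coord y) B
    coord-spec y = proj₂ (B-spans y)

    coord-unique : ∀ {y} cs → y ≈ᴹ lincomb cs B → ∀ t → coord y t ≈ cs t
    coord-unique {y} cs y≈ t = x+-1*y≈0⇒x≈y _ _ (B-independent diff diff≈0 t)
      where
        diff : Fin v → Carrier
        diff t = coord y t +F ((-F 1#) *F cs t)
        diff≈0 : lincomb diff B ≈ᴹ 0ᴹ
        diff≈0 = begin
            lincomb diff B
              ≈⟨ lincomb-distribˡ (coord y) _ B ⟩
            lincomb (coord y) B +ᴹ lincomb (λ t → (-F 1#) *F cs t) B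
              ≈⟨ +ᴹ-cong (≈ᴹ-trans (≈ᴹ-sym (coord-spec y)) y≈) (lincomb-*ₗ (-F 1#) cs B) ⟩
            lincomb cs B +ᴹ ((-F 1#) *ₗ lincomb cs B)
              ≈⟨ x+-1x≈0 _ ⟩
            0ᴹ ∎
          where open ≈ᴹ-Reasoning

    coord-resp : ∀ {x y} → x ≈ᴹ y → ∀ t → coord x t ≈ coord y t
    coord-resp {x} x≈y t = R.sym (coord-unique (coord x) (≈ᴹ-trans (≈ᴹ-sym x≈y) (coord-spec x)) t)

    coord-+ᴹ : ∀ x y t → coord (x +ᴹ y) t ≈ coord x t +F coord y t
    coord-+ᴹ x y t = coord-unique _ (≈ᴹ-trans (+ᴹ-cong (coord-spec x) (coord-spec y)) (≈ᴹ-sym (lincomb-distribˡ _ _ B))) t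

    coord-*ₗ : ∀ a x t → coord (a *ₗ x) t ≈ a *F coord x t
    coord-*ₗ a x t = coord-unique _ (≈ᴹ-trans (*ₗ-congˡ (coord-spec x)) (≈ᴹ-sym (lincomb-*ₗ a _ B))) t

    coord-+*ₗ : ∀ x a y t → coord (x +ᴹ (a *ₗ y)) t ≈ coord x t +F (a *F coord y t)
    coord-+*ₗ x a y t = R.trans (coord-+ᴹ x _ t) (R.+-congˡ (coord-*ₗ a y t))

    coord-0 : ∀ t → coord 0ᴹ t ≈ 0#
    coord-0 t = coord-unique _ (≈ᴹ-sym (lincomb-zeroˡ {f = B} (λ _ → R.refl))) t

    coord-basis : ∀ s t → coord (B s) t ≈ δ s t
    coord-basis s t = coord-unique (δ s) (≈ᴹ-sym (lincomb-δ s B)) t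

    coord-lincomb : ∀ {n} (cs : Fin n → Carrier) (f : Fin n → Carrierᴹ) t →
                    coord (lincomb cs f) t ≈ ΣF.sum (λ i → cs i *F coord (f i) t)
    coord-lincomb {zero} cs f t = coord-0 t
    coord-lincomb {suc n} cs f t =
      R.trans (coord-+ᴹ _ _ t) (R.+-cong (coord-*ₗ (cs zero) (f zero) t) (coord-lincomb (cs ∘ suc) (f ∘ suc) t))

    Below : ℕ → Carrierᴹ → Set ℓ
    Below j y = ∀ t → j ≤ toℕ t → coord y t ≈ 0#

    Lead : Carrierᴹ → Fin v → Set ℓ
    Lead y t = (¬ coord y t ≈ 0#) × (∀ t′ → t Fin.< t′ → coord y t′ ≈ 0#)

    Below-resp : ∀ {j x y} → x ≈ᴹ y → Below j x → Below j y
    Below-resp x≈y below t j≤t = R.trans (R.sym (coord-resp x≈y t)) (below t j≤t)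

    Below-0 : ∀ {j} → Below j 0ᴹ
    Below-0 t _ = coord-0 t

    Below-mono : ∀ {j j′ y} → j ≤ j′ → Below j y → Below j′ y
    Below-mono j≤j′ below t j′≤t = below t (ℕₚ.≤-trans j≤j′ j′≤t)

    Below-v : ∀ y → Below v y
    Below-v y t v≤t = ⊥-elim (ℕₚ.<⇒≱ (Finₚ.toℕ<n t) v≤t)

    Below-lincomb : ∀ {j n} (cs : Fin n → Carrier) (f : Fin n → Carrierᴹ) →
                    (∀ i → Below j (f i)) → Below j (lincomb cs f)
    Below-lincomb cs f below t j≤t =
      R.trans (coord-lincomb cs f t) (sum-≈ε +-commutativeMonoid (λ i → R.trans (R.*-congˡ (below i t j≤t)) (R.zeroʳ _)))

    Below-+*ₗ : ∀ {j x y} a → Below j x → Below j y → Below j (x +ᴹ (a *ₗ y))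
    Below-+*ₗ a x-below y-below t j≤t =
      R.trans (coord-+*ₗ _ a _ t)
        (R.trans (R.+-cong (x-below t j≤t) (R.trans (R.*-congˡ (y-below t j≤t)) (R.zeroʳ a))) (R.+-identityˡ 0#))

    Below-0⇒≈0 : ∀ {y} → Below 0 y → y ≈ᴹ 0ᴹ
    Below-0⇒≈0 {y} below = ≈ᴹ-trans (coord-spec y) (lincomb-zeroˡ {f = B} (λ t → below t z≤n))

    Below-step : ∀ {j y} (τ : Fin v) → toℕ τ ≡ j → Below (suc j) y → coord y τ ≈ 0# → Below j y
    Below-step {j} {y} τ τ≡j below c≈0 t j≤t with toℕ t ℕₚ.≟ j
    ... | yes t≡j = subst (λ t → coord y t ≈ 0#) (Finₚ.toℕ-injective (trans τ≡j (sym t≡j))) c≈0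
    ... | no t≢j = below t (ℕₚ.≤∧≢⇒< j≤t (t≢j ∘ sym))

    Lead-resp : ∀ {x y t} → x ≈ᴹ y → Lead x t → Lead y t
    Lead-resp x≈y (c≉0 , above) =
        (λ c≈0 → c≉0 (R.trans (coord-resp x≈y _) c≈0))
      , (λ t′ t<t′ → R.trans (R.sym (coord-resp x≈y t′)) (above t′ t<t′))

    Lead-unique : ∀ {y t t′} → Lead y t → Lead y t′ → t ≡ t′
    Lead-unique {y} {t} {t′} (c≉0 , above) (c′≉0 , above′) with ℕₚ.<-cmp (toℕ t) (toℕ t′)
    ... | tri< t<t′ _ _ = ⊥-elim (c′≉0 (above t′ t<t′))
    ... | tri≈ _ t≡t′ _ = Finₚ.toℕ-injective t≡t′
    ... | tri> _ _ t′<t = ⊥-elim (c≉0 (above′ t t′<t))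

    Lead⇒Below : ∀ {y t} → Lead y t → Below (suc (toℕ t)) y
    Lead⇒Below (_ , above) = above

    Below∧Lead⇒< : ∀ {j y t} → Below j y → Lead y t → toℕ t < j
    Below∧Lead⇒< {j} {y} {t} below (c≉0 , _) with toℕ t ℕₚ.<? j
    ... | yes t<j = t<j
    ... | no t≮j = ⊥-elim (c≉0 (below t (ℕₚ.≮⇒≥ t≮j)))

    eliminate : (y z : Carrierᴹ) (τ : Fin v) → ¬ coord z τ ≈ 0# → Carrierᴹ
    eliminate y z τ c≉0 = y +ᴹ ((-F (coord y τ *F inv (coord z τ) c≉0)) *ₗ z)

    Below-eliminate : ∀ {j y z} (τ : Fin v) → toℕ τ ≡ j → Below (suc j) y → Below (suc j) z →
                      (c≉0 : ¬ coord z τ ≈ 0#) → Below j (eliminate y z τ c≉0)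
    Below-eliminate τ τ≡j y-below z-below c≉0 =
      Below-step τ τ≡j (Below-+*ₗ _ y-below z-below) (R.trans (coord-+*ₗ _ _ _ τ) (x-[x/d]*d≈0 _ _ c≉0))

    span-eliminate : ∀ {n} {f : Fin n → Carrierᴹ} {y z} τ c≉0 →
                     Span f y → Span f z → Span f (eliminate y z τ c≉0)
    span-eliminate τ c≉0 y∈ z∈ = span-+ y∈ (span-*ₗ _ z∈)

    span-eliminate⁻¹ : ∀ {n} {f : Fin n → Carrierᴹ} {y z} τ c≉0 →
                       Span f (eliminate y z τ c≉0) → Span f z → Span f y
    span-eliminate⁻¹ {y = y} {z} τ c≉0 y′∈ z∈ =
      span-resp ([x-az]+az≈x y _ z) (span-+ y′∈ (span-*ₗ (coord y τ *F inv (coord z τ) c≉0) z∈))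

    module DistinctLeads {n} (f : Fin n → Carrierᴹ) (lead : Fin n → Fin v)
                         (lead-injective : Injective _≡_ _≡_ lead) (isLead : ∀ i → Lead (f i) (lead i)) where

      lead-of-lincomb : (cs : Fin n → Carrier) → (∀ i → cs i ≈ 0#) ⊎
                        (∃ λ i₀ → (¬ cs i₀ ≈ 0#) × Lead (lincomb cs f) (lead i₀) ×
                                  (∀ i → ¬ cs i ≈ 0# → lead i Fin.≤ lead i₀))
      lead-of-lincomb cs with argmax (λ i → ¬ cs i ≈ 0#) (λ i → ¬? (cs i ≈? 0#)) (toℕ ∘ lead)
      ... | inj₁ all≈0 = inj₁ (λ i → ≈-stable (all≈0 i))
      ... | inj₂ (i₀ , c₀≉0 , highest) = inj₂ (i₀ , c₀≉0 , (at-lead≉0 , above-lead≈0) , highest)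
        where
          term : Fin v → Fin n → Carrier
          term τ i = cs i *F coord (f i) τ
          term≈0 : ∀ τ i → (¬ cs i ≈ 0# → lead i Fin.< τ) → term τ i ≈ 0#
          term≈0 τ i lead<τ with cs i ≈? 0#
          ... | yes c≈0 = R.trans (R.*-congʳ c≈0) (R.zeroˡ _)
          ... | no c≉0 = R.trans (R.*-congˡ (proj₂ (isLead i) τ (lead<τ c≉0))) (R.zeroʳ _)
          above-lead≈0 : ∀ τ → lead i₀ Fin.< τ → coord (lincomb cs f) τ ≈ 0#
          above-lead≈0 τ i₀<τ = R.trans (coord-lincomb cs f τ)
            (sum-≈ε +-commutativeMonoid (λ i → term≈0 τ i (λ c≉0 → ℕₚ.≤-<-trans (highest i c≉0) i₀<τ)))
          at-lead≉0 : ¬ coord (lincomb cs f) (lead i₀) ≈ 0#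
          at-lead≉0 c≈0 = *-nonzero c₀≉0 (proj₁ (isLead i₀)) (R.trans
            (R.sym (sum-≈single +-commutativeMonoid (term (lead i₀)) i₀ (λ i i≢i₀ → term≈0 (lead i₀) i
              (λ c≉0 → ℕₚ.≤∧≢⇒< (highest i c≉0) (i≢i₀ ∘ lead-injective ∘ Finₚ.toℕ-injective)))))
            (R.trans (R.sym (coord-lincomb cs f (lead i₀))) c≈0))

      coefficients-above-vanish : ∀ {y j} cs → y ≈ᴹ lincomb cs f → Below j y →
                                  ∀ i → j ≤ toℕ (lead i) → cs i ≈ 0#
      coefficients-above-vanish {y} {j} cs y≈ below i j≤lead with lead-of-lincomb cs
      ... | inj₁ all≈0 = all≈0 i
      ... | inj₂ (i₀ , _ , isLead₀ , highest) =
        ≈-stable λ c≉0 →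
          ℕₚ.<⇒≱ (ℕₚ.≤-<-trans (highest i c≉0) (Below∧Lead⇒< below (Lead-resp (≈ᴹ-sym y≈) isLead₀))) j≤lead

      independent : Independent f
      independent cs ∑≈0 i = coefficients-above-vanish cs (≈ᴹ-sym ∑≈0) Below-0 i z≤n

      lead-in-span : ∀ {y t} → Span f y → Lead y t → ∃ λ i → lead i ≡ t
      lead-in-span {y} {t} (cs , y≈) y-lead with lead-of-lincomb cs
      ... | inj₁ all≈0 =
        ⊥-elim (proj₁ y-lead (R.trans (coord-resp (≈ᴹ-trans y≈ (lincomb-zeroˡ {f = f} all≈0)) t) (coord-0 t)))
      ... | inj₂ (i₀ , _ , isLead₀ , _) = i₀ , Lead-unique (Lead-resp (≈ᴹ-sym y≈) isLead₀) y-lead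

    record Echelon {n} (t : ℕ) (w : Fin n → Carrierᴹ) : Set (c ⊔ ℓ ⊔ m ⊔ ℓm) where
      field
        rank : ℕ
        vec : Fin rank → Carrierᴹ
        lead : Fin rank → Fin v
        lead<t : ∀ i → toℕ (lead i) < t
        decreasing : StrictlyDecreasing lead
        isLead : ∀ i → Lead (vec i) (lead i)
        vec∈span : ∀ i → Span w (vec i)
        span∋w : ∀ i → Span vec (w i)
        rank≡ : Independent w → rank ≡ n

      open DistinctLeads vec lead (strictlyDecreasing⇒injective decreasing) isLead public

    echelon-empty : ∀ {t} (w : Fin 0 → Carrierᴹ) → Echelon t w
    echelon-empty w = record
      { rank = 0 ; vec = λ () ; lead = λ () ; lead<t = λ () ; decreasing = λ () ; isLead = λ ()
      ; vec∈span = λ () ; span∋w = λ () ; rank≡ = λ _ → refl }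

    echelon-zero : ∀ {n} (w : Fin n → Carrierᴹ) → (∀ i → Below 0 (w i)) → Echelon 0 w
    echelon-zero {n} w below = record
      { rank = 0 ; vec = λ () ; lead = λ () ; lead<t = λ () ; decreasing = λ () ; isLead = λ ()
      ; vec∈span = λ () ; span∋w = λ i → (λ ()) , Below-0⇒≈0 (below i)
      ; rank≡ = independent-zeros⇒empty w (λ i → Below-0⇒≈0 (below i)) }

    echelon-weaken : ∀ {t n} {w : Fin n → Carrierᴹ} → Echelon t w → Echelon (suc t) w
    echelon-weaken E = record { Echelon E ; lead<t = λ i → ℕₚ.m<n⇒m<1+n (Echelon.lead<t E i) }

    module Pivot {t} (t<v : t < v) {n} (w : Fin (suc n) → Carrierᴹ) (w-below : ∀ i → Below (suc t) (w i))
                 (p : Fin (suc n)) (p≉0 : ¬ coord (w p) (Fin.fromℕ< t<v) ≈ 0#) where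

      τ : Fin v
      τ = Fin.fromℕ< t<v

      τ≡t : toℕ τ ≡ t
      τ≡t = Finₚ.toℕ-fromℕ< t<v

      reduced : Fin n → Carrierᴹ
      reduced i = eliminate (w (punchIn p i)) (w p) τ p≉0

      reduced-below : ∀ i → Below t (reduced i)
      reduced-below i = Below-eliminate τ τ≡t (w-below (punchIn p i)) (w-below p) p≉0

      reduced-independent : Independent w → Independent reduced
      reduced-independent indep cs ∑≈0 i =
        R.trans (R.reflexive (sym (insertAt-punchIn cs p β i))) (indep (insertAt cs p β) ∑′≈0 (punchIn p i))
        where
          α : Fin n → Carrier
          α i = -F (coord (w (punchIn p i)) τ *F inv (coord (w p) τ) p≉0)
          β = ΣF.sum (λ i → cs i *F α i)
          ∑′≈0 : lincomb (insertAt cs p β) w ≈ᴹ 0ᴹ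
          ∑′≈0 = begin
              lincomb (insertAt cs p β) w                              ≈⟨ lincomb-insertAt p β cs w ⟩
              (β *ₗ w p) +ᴹ lincomb cs (removeAt w p)                  ≈⟨ +ᴹ-comm _ _ ⟩
              lincomb cs (removeAt w p) +ᴹ (β *ₗ w p)                  ≈⟨ +ᴹ-congˡ (lincomb-multiples cs α (w p)) ⟨
              lincomb cs (removeAt w p) +ᴹ lincomb cs (λ i → α i *ₗ w p) ≈⟨ lincomb-distribʳ cs (removeAt w p) _ ⟨
              lincomb cs reduced                                       ≈⟨ ∑≈0 ⟩
              0ᴹ                                                       ∎
            where open ≈ᴹ-Reasoning

      extend : Echelon t reduced → Echelon (suc t) w
      extend E = record
        { rank = suc rank
        ; vec = vec′
        ; lead = lead′
        ; lead<t = lead′<t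
        ; decreasing = decreasing′
        ; isLead = isLead′
        ; vec∈span = vec′∈span
        ; span∋w = span∋w′
        ; rank≡ = λ indep → cong suc (rank≡ (reduced-independent indep))
        }
        where
          open Echelon E
          vec′ : Fin (suc rank) → Carrierᴹ
          vec′ = insertAt vec zero (w p)
          lead′ : Fin (suc rank) → Fin v
          lead′ = insertAt lead zero τ
          lead′<t : ∀ i → toℕ (lead′ i) < suc t
          lead′<t zero = ℕₚ.≤-reflexive (cong suc τ≡t)
          lead′<t (suc i) = ℕₚ.m<n⇒m<1+n (lead<t i)
          decreasing′ : StrictlyDecreasing lead′
          decreasing′ zero (suc j) _ = subst (toℕ (lead j) <_) (sym τ≡t) (lead<t j)
          decreasing′ (suc i) (suc j) (s≤s i<j) = decreasing i j i<j
          isLead′ : ∀ i → Lead (vec′ i) (lead′ i)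
          isLead′ zero = p≉0 , λ t′ τ<t′ → w-below p t′ (subst (_< toℕ t′) τ≡t τ<t′)
          isLead′ (suc i) = isLead i
          vec′∈span : ∀ i → Span w (vec′ i)
          vec′∈span zero = span-generator w p
          vec′∈span (suc i) =
            span-trans {f = w} {g = reduced}
              (λ j → span-eliminate {f = w} τ p≉0 (span-generator w (punchIn p j)) (span-generator w p)) (vec∈span i)
          span∋w′ : ∀ i → Span vec′ (w i)
          span∋w′ i with p Finₚ.≟ i
          ... | yes refl = span-generator vec′ zero
          ... | no p≢i = subst (Span vec′ ∘ w) (Finₚ.punchIn-punchOut p≢i)
                           (span-eliminate⁻¹ {f = vec′} τ p≉0 (span-insert₀ (w p) (span∋w (punchOut p≢i)))
                                                            (span-generator vec′ zero))

    echelon : ∀ t → t ≤ v → ∀ {n} (w : Fin n → Carrierᴹ) → (∀ i → Below t (w i)) → Echelon t w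
    echelon zero _ w below = echelon-zero w below
    echelon (suc t) t<v {zero} w below = echelon-empty w
    echelon (suc t) t<v {suc n} w below with Finₚ.any? (λ i → ¬? (coord (w i) (Fin.fromℕ< t<v) ≈? 0#))
    ... | yes (p , p≉0) = Pivot.extend t<v w below p p≉0
                            (echelon t (ℕₚ.<⇒≤ t<v) _ (Pivot.reduced-below t<v w below p p≉0))
    ... | no none = echelon-weaken (echelon t (ℕₚ.<⇒≤ t<v) w λ i →
                      Below-step (Fin.fromℕ< t<v) (Finₚ.toℕ-fromℕ< t<v) (below i) (≈-stable (λ c≉0 → none (i , c≉0))))

    echelon-all : ∀ {n} (w : Fin n → Carrierᴹ) → Echelon v w
    echelon-all w = echelon v ℕₚ.≤-refl w (λ i → Below-v (w i))

    -- Both echelon forms span the same space, so leads embed each into the other.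
    HasDim-≤ : ∀ {P : VSet} {d d′} → HasDim P d → HasDim P d′ → d ≤ d′
    HasDim-≤ (b , b∈ , b-indep , _) (b′ , _ , b′-indep , b′-spans) =
        subst₂ _≤_ (Echelon.rank≡ E b-indep) (Echelon.rank≡ E′ b′-indep) (Finₚ.injective⇒≤ match-injective)
      where
        E = echelon-all b
        E′ = echelon-all b′
        E∈E′ : ∀ i → Span (Echelon.vec E′) (Echelon.vec E i)
        E∈E′ i = span-trans (Echelon.span∋w E′) (span-trans (λ j → b′-spans (b j) (b∈ j)) (Echelon.vec∈span E i))
        match : ∀ i → ∃ λ j → Echelon.lead E′ j ≡ Echelon.lead E i
        match i = Echelon.lead-in-span E′ (E∈E′ i) (Echelon.isLead E i)
        match-injective : Injective _≡_ _≡_ (proj₁ ∘ match)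
        match-injective {i} {j} e = strictlyDecreasing⇒injective (Echelon.decreasing E)
          (trans (sym (proj₂ (match i))) (trans (cong (Echelon.lead E′) e) (proj₂ (match j))))

    HasDim-unique : ∀ {P : VSet} {d d′} → HasDim P d → HasDim P d′ → d ≡ d′
    HasDim-unique h h′ = ℕₚ.≤-antisym (HasDim-≤ h h′) (HasDim-≤ h′ h)

    independent⇒spanning : ∀ {n} (w : Fin n → Carrierᴹ) → Independent w → v ≤ n → ∀ y → Span w y
    independent⇒spanning w indep v≤n y = span-trans vec∈span (span-below v ℕₚ.≤-refl y (Below-v y))
      where
        open Echelon (echelon-all w)
        lead-onto : ∀ τ → ∃ λ i → lead i ≡ τ
        lead-onto = injective⇒surjective (subst (v ≤_) (sym (rank≡ indep)) v≤n)
                                         (strictlyDecreasing⇒injective decreasing)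
        span-below : ∀ j → j ≤ v → ∀ y → Below j y → Span vec y
        span-below zero _ y below = span-resp (≈ᴹ-sym (Below-0⇒≈0 below)) span-0
        span-below (suc j) j<v y below =
          span-eliminate⁻¹ τ c≉0 (span-below j (ℕₚ.<⇒≤ j<v) _ (Below-eliminate τ τ≡j below vᵢ-below c≉0))
                                 (span-generator vec i)
          where
            τ = Fin.fromℕ< j<v
            τ≡j = Finₚ.toℕ-fromℕ< j<v
            i = proj₁ (lead-onto τ)
            vᵢ-lead : Lead (vec i) τ
            vᵢ-lead = subst (Lead (vec i)) (proj₂ (lead-onto τ)) (isLead i)
            c≉0 = proj₁ vᵢ-lead
            vᵢ-below : Below (suc j) (vec i)
            vᵢ-below = subst (λ z → Below (suc z) (vec i)) τ≡j (Lead⇒Below vᵢ-lead)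

  module Chain (v : ℕ) (V-dim : VDim v) (U : ℕ → Subspace) (chain : MaximalChain v U) where

    U-step : ∀ j → suc j ≤ v → U j ⊂ U (suc j)
    U-step = proj₂ (proj₂ chain)

    U-mono : ∀ {j j′} → j ≤ j′ → j′ ≤ v → U j ⊆ U j′
    U-mono {j′ = zero} z≤n _ y y∈ = y∈
    U-mono {j} {suc j′} j≤1+j′ 1+j′≤v y y∈ with ℕₚ.m≤n⇒m<n∨m≡n j≤1+j′
    ... | inj₂ refl = y∈
    ... | inj₁ j<1+j′ = proj₁ (U-step j′ 1+j′≤v) y (U-mono (ℕₚ.≤-pred j<1+j′) (ℕₚ.<⇒≤ 1+j′≤v) y y∈)

    x : Fin v → Carrierᴹ
    x t = proj₁ (proj₂ (U-step (toℕ t) (Finₚ.toℕ<n t)))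

    x∉U : ∀ t → ¬ (U (toℕ t) ∋ x t)
    x∉U t = proj₂ (proj₂ (proj₂ (U-step (toℕ t) (Finₚ.toℕ<n t))))

    x∈U : ∀ t {j} → toℕ t < j → j ≤ v → U j ∋ x t
    x∈U t t<j j≤v = U-mono t<j j≤v (x t) (proj₁ (proj₂ (proj₂ (U-step (toℕ t) (Finₚ.toℕ<n t)))))

    x-independent : Independent x
    x-independent = chain⇒independent x (U ∘ toℕ) (λ t i i<t → x∈U i i<t (ℕₚ.<⇒≤ (Finₚ.toℕ<n t))) x∉U

    x-spanning : ∀ y → Span x y
    x-spanning = independent⇒spanning x x-independent ℕₚ.≤-refl
      where open Coordinates (proj₁ V-dim) (proj₁ (proj₂ (proj₂ V-dim))) (λ y → proj₂ (proj₂ (proj₂ V-dim)) y tt)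

    open Coordinates x x-independent x-spanning public

    x-lead : ∀ s → Lead (x s) s
    x-lead s = (λ c≈0 → 1≉0 (R.trans (R.sym (R.trans (coord-basis s s) (δ-diag s))) c≈0))
             , λ t s<t → R.trans (coord-basis s t) (δ-offdiag (λ s≡t → ℕₚ.<-irrefl (cong toℕ s≡t) s<t))

    Below⇒∈U : ∀ {j y} → j ≤ v → Below j y → U j ∋ y
    Below⇒∈U {j} {y} j≤v below = resp (U j) (≈ᴹ-sym (coord-spec y)) (∋-lincomb-terms (U j) (coord y) term∈)
      where
        term∈ : ∀ t → U j ∋ (coord y t *ₗ x t)
        term∈ t with suc (toℕ t) ℕₚ.≤? j
        ... | yes t<j = close* (U j) _ (x∈U t t<j j≤v)
        ... | no t≮j = ∋-zero*ₗ (U j) (below t (ℕₚ.≤-pred (ℕₚ.≰⇒> t≮j)))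

    -- If the highest nonzero coordinate t₀ of y ∈ U j had t₀ ≥ j, clearing it would put x t₀ into U t₀.
    ∈U⇒Below : ∀ {j y} → j ≤ v → U j ∋ y → Below j y
    ∈U⇒Below {j} {y} j≤v y∈ t j≤t
      with argmax (λ t′ → (j ≤ toℕ t′) × ¬ coord y t′ ≈ 0#)
                  (λ t′ → (j ℕₚ.≤? toℕ t′) ×-dec ¬? (coord y t′ ≈? 0#)) toℕ
    ... | inj₁ none = ≈-stable (λ c≉0 → none t (j≤t , c≉0))
    ... | inj₂ (t₀ , (j≤t₀ , c₀≉0) , highest) = ⊥-elim (x∉U t₀ x₀∈)
      where
        W = U (toℕ t₀)
        t₀≤v = ℕₚ.<⇒≤ (Finₚ.toℕ<n t₀)
        d≉0 = proj₁ (x-lead t₀)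
        y-below : Below (suc (toℕ t₀)) y
        y-below t′ t₀<t′ = ≈-stable λ c≉0 →
          ℕₚ.<⇒≱ t₀<t′ (highest t′ (ℕₚ.≤-trans j≤t₀ (ℕₚ.<⇒≤ t₀<t′) , c≉0))
        y′∈ : W ∋ eliminate y (x t₀) t₀ d≉0
        y′∈ = Below⇒∈U t₀≤v (Below-eliminate t₀ refl y-below (Lead⇒Below (x-lead t₀)) d≉0)
        x₀∈ : W ∋ x t₀
        x₀∈ = ∋-*ₗ⁻¹ W (-‿nonzero (*-nonzero c₀≉0 (inv-nonzero _ d≉0)))
                (resp W ([y+x]-y≈x _ y) (∋-sub W y′∈ (U-mono j≤t₀ t₀≤v y y∈)))

    x-prefix : ∀ {t} → t ≤ v → Fin t → Carrierᴹ
    x-prefix t≤v i = x (inject≤ i t≤v)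

    x-prefix-below : ∀ {t} (t≤v : t ≤ v) i → Below t (x-prefix t≤v i)
    x-prefix-below t≤v i =
      Below-mono (subst (_< _) (sym (Finₚ.toℕ-inject≤ i t≤v)) (Finₚ.toℕ<n i)) (Lead⇒Below (x-lead (inject≤ i t≤v)))

    x-prefix-independent : ∀ {t} (t≤v : t ≤ v) → Independent (x-prefix t≤v)
    x-prefix-independent t≤v = DistinctLeads.independent (x-prefix t≤v) (λ i → inject≤ i t≤v)
      (Finₚ.inject≤-injective t≤v t≤v _ _) (λ i → x-lead (inject≤ i t≤v))

    Below⇒span-x-prefix : ∀ {t} (t≤v : t ≤ v) {y} → Below t y → Span (x-prefix t≤v) y
    Below⇒span-x-prefix {t} t≤v {y} below = (coord y ∘ (λ i → inject≤ i t≤v)) ,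
      ≈ᴹ-trans (coord-spec y) (≈ᴹ-trans (lincomb-prefix+suffix t t≤v (coord y) x)
        (≈ᴹ-trans (+ᴹ-congˡ (lincomb-zeroˡ {f = x ∘ raise∸ t} λ i →
                    below (raise∸ t i) (subst (t ≤_) (sym (toℕ-raise∸ t i)) (ℕₚ.m≤m+n t _))))
          (+ᴹ-identityʳ _)))

    dim-U : ∀ {t} → t ≤ v → dim U t ≡ t
    dim-U t≤v = x-prefix t≤v , (λ i → Below⇒∈U t≤v (x-prefix-below t≤v i)) , x-prefix-independent t≤v
              , (λ y y∈ → Below⇒span-x-prefix t≤v (∈U⇒Below t≤v y∈))

    record EchelonBasis (K : Subspace) : Set (c ⊔ ℓ ⊔ m ⊔ ℓm) where
      field
        rank : ℕ
        vec : Fin rank → Carrierᴹ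
        lead : Fin rank → Fin v
        decreasing : StrictlyDecreasing lead
        isLead : ∀ i → Lead (vec i) (lead i)
        vec∈K : ∀ i → K ∋ vec i
        K⊆span : ∀ y → K ∋ y → Span vec y

      lead-injective : Injective _≡_ _≡_ lead
      lead-injective = strictlyDecreasing⇒injective decreasing

      open DistinctLeads vec lead lead-injective isLead public

    echelonBasis : (K : Subspace) → ∀ {n} (g : Fin n → Carrierᴹ) → (∀ i → K ∋ g i) → (∀ y → K ∋ y → Span g y) →
                   EchelonBasis K
    echelonBasis K g g∈K K⊆span-g = record
      { Echelon E
      ; vec∈K = λ i → resp K (≈ᴹ-sym (proj₂ (vec∈span i))) (∋-lincomb K (proj₁ (vec∈span i)) g∈K)
      ; K⊆span = λ y y∈ → span-trans span∋w (K⊆span-g y y∈) }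
      where
        E = echelon-all g
        open Echelon E using (vec∈span; span∋w)

    echelonBasis-rank : (K : Subspace) → ∀ {n} (g : Fin n → Carrierᴹ) g∈K K⊆span-g → Independent g →
                        EchelonBasis.rank (echelonBasis K g g∈K K⊆span-g) ≡ n
    echelonBasis-rank K g _ _ = Echelon.rank≡ (echelon-all g)

    dim-echelonBasis : ∀ {K} (E : EchelonBasis K) → dim K ≡ EchelonBasis.rank E
    dim-echelonBasis E = vec , vec∈K , independent , K⊆span
      where open EchelonBasis E

    module _ {K : Subspace} (E : EchelonBasis K) where
      open EchelonBasis E

      tail-below : ∀ {t p} → SplitsAt lead t p → ∀ i → Below t (vec (raise∸ p i))
      tail-below {t} {p} (_ , _ , below) i =
        Below-mono (below (raise∸ p i) (subst (p ≤_) (sym (toℕ-raise∸ p i)) (ℕₚ.m≤m+n p _)))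
                   (Lead⇒Below (isLead (raise∸ p i)))

      dim-U∩ : ∀ {t p} → t ≤ v → SplitsAt lead t p → HasDim (U t ∩ K) (rank ∸ p)
      dim-U∩ {t} {p} t≤v sp@(p≤r , above , _) = vec ∘ raise∸ p , tail∈ , tail-independent , tail-spans
        where
          tail∈ : ∀ i → (U t ∩ K) (vec (raise∸ p i))
          tail∈ i = Below⇒∈U t≤v (tail-below sp i) , vec∈K (raise∸ p i)
          tail-independent = DistinctLeads.independent (vec ∘ raise∸ p) (lead ∘ raise∸ p)
            (raise∸-injective p ∘ lead-injective) (isLead ∘ raise∸ p)
          tail-spans : ∀ y → (U t ∩ K) y → Span (vec ∘ raise∸ p) y
          tail-spans y (y∈U , y∈K) = cs ∘ raise∸ p ,
              ≈ᴹ-trans y≈ (≈ᴹ-trans (lincomb-prefix+suffix p p≤r cs vec)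
                (≈ᴹ-trans (+ᴹ-congʳ (lincomb-zeroˡ {f = vec ∘ (λ i → inject≤ i p≤r)} head≈0)) (+ᴹ-identityˡ _)))
            where
              cs = proj₁ (K⊆span y y∈K)
              y≈ = proj₂ (K⊆span y y∈K)
              head≈0 : ∀ i → cs (inject≤ i p≤r) ≈ 0#
              head≈0 i = coefficients-above-vanish cs y≈ (∈U⇒Below t≤v y∈U) (inject≤ i p≤r)
                (above _ (subst (_< p) (sym (Finₚ.toℕ-inject≤ i p≤r)) (Finₚ.toℕ<n i)))

      module U+K {t p} (t≤v : t ≤ v) (sp : SplitsAt lead t p) where
        p≤r = proj₁ sp

        head : Fin p → Carrierᴹ
        head i = vec (inject≤ i p≤r)

        module Head = DistinctLeads head (λ i → lead (inject≤ i p≤r))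
          (λ e → Finₚ.inject≤-injective p≤r p≤r _ _ (lead-injective e)) (λ i → isLead (inject≤ i p≤r))

        head-above : ∀ i → t ≤ toℕ (lead (inject≤ i p≤r))
        head-above i = proj₁ (proj₂ sp) _ (subst (_< p) (sym (Finₚ.toℕ-inject≤ i p≤r)) (Finₚ.toℕ<n i))

        basis : Fin (t + p) → Carrierᴹ
        basis = x-prefix t≤v ++ head

        basis∈ : ∀ i → (U t ⊕ K) (basis i)
        basis∈ = ↑-elim {P = λ i → (U t ⊕ K) (basis i)}
          (λ a → subst (U t ⊕ K) (sym (lookup-++ˡ (x-prefix t≤v) head a))
                   (_ , 0ᴹ , Below⇒∈U t≤v (x-prefix-below t≤v a) , has0 K , ≈ᴹ-sym (+ᴹ-identityʳ _)))
          (λ b → subst (U t ⊕ K) (sym (lookup-++ʳ (x-prefix t≤v) head b))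
                   (0ᴹ , _ , has0 (U t) , vec∈K _ , ≈ᴹ-sym (+ᴹ-identityˡ _)))

        -- The K-part of a vanishing combination lies in U t, which no nonzero combination of head does.
        basis-independent : Independent basis
        basis-independent cs ∑≈0 = ↑-elim {P = λ i → cs i ≈ 0#} x-coeffs≈0 head-coeffs≈0
          where
            cx = cs ∘ (_↑ˡ p)
            ch = cs ∘ (t ↑ʳ_)
            Lx = lincomb cx (x-prefix t≤v)
            Lh = lincomb ch head
            Lx+Lh≈0 : Lx +ᴹ Lh ≈ᴹ 0ᴹ
            Lx+Lh≈0 = ≈ᴹ-trans (≈ᴹ-sym (lincomb-++ cx ch (x-prefix t≤v) head))
                        (≈ᴹ-trans (lincomb-cong (λ i → R.reflexive (sym (cs≡cx++ch i))) (λ _ → ≈ᴹ-refl)) ∑≈0)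
              where
                cs≡cx++ch : ∀ i → cs i ≡ (cx ++ ch) i
                cs≡cx++ch = ↑-elim {P = λ i → cs i ≡ (cx ++ ch) i}
                  (λ a → sym (lookup-++ˡ cx ch a)) (λ b → sym (lookup-++ʳ cx ch b))
            Lh-below : Below t Lh
            Lh-below = Below-resp (≈ᴹ-trans (+ᴹ-congʳ (≈ᴹ-sym Lx+Lh≈0)) ([y+x]-y≈x Lh Lx))
                         (Below-+*ₗ (-F 1#) Below-0 (Below-lincomb cx _ (x-prefix-below t≤v)))
            head-coeffs≈0 : ∀ b → ch b ≈ 0#
            head-coeffs≈0 b = Head.coefficients-above-vanish ch ≈ᴹ-refl Lh-below b (head-above b)
            x-coeffs≈0 : ∀ a → cx a ≈ 0#
            x-coeffs≈0 = x-prefix-independent t≤v cx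
              (≈ᴹ-trans (≈ᴹ-sym (+ᴹ-identityʳ Lx))
                (≈ᴹ-trans (+ᴹ-congˡ (≈ᴹ-sym (lincomb-zeroˡ {f = head} head-coeffs≈0))) Lx+Lh≈0))

        basis-spanning : ∀ y → (U t ⊕ K) y → Span basis y
        basis-spanning y (u , w , u∈ , w∈ , y≈u+w) = cx ++ (cs ∘ (λ i → inject≤ i p≤r)) , y≈
          where
            cs = proj₁ (K⊆span w w∈)
            Lh = lincomb (cs ∘ (λ i → inject≤ i p≤r)) head
            Lt = lincomb (cs ∘ raise∸ p) (vec ∘ raise∸ p)
            u+Lt-below : Below t (u +ᴹ Lt)
            u+Lt-below = Below-resp (≈ᴹ-trans (+ᴹ-congˡ (*ₗ-identityˡ u)) (+ᴹ-comm Lt u))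
                           (Below-+*ₗ 1# (Below-lincomb _ _ (tail-below sp)) (∈U⇒Below t≤v u∈))
            cx = proj₁ (Below⇒span-x-prefix t≤v u+Lt-below)
            y≈ : y ≈ᴹ lincomb (cx ++ (cs ∘ (λ i → inject≤ i p≤r))) basis
            y≈ = begin
                y                       ≈⟨ y≈u+w ⟩
                u +ᴹ w                  ≈⟨ +ᴹ-congˡ (≈ᴹ-trans (proj₂ (K⊆span w w∈)) (lincomb-prefix+suffix p p≤r cs vec)) ⟩
                u +ᴹ (Lh +ᴹ Lt)         ≈⟨ +ᴹ-congˡ (+ᴹ-comm Lh Lt) ⟩
                u +ᴹ (Lt +ᴹ Lh)         ≈⟨ +ᴹ-assoc u Lt Lh ⟨
                (u +ᴹ Lt) +ᴹ Lh         ≈⟨ +ᴹ-congʳ (proj₂ (Below⇒span-x-prefix t≤v u+Lt-below)) ⟩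
                lincomb cx (x-prefix t≤v) +ᴹ Lh ≈⟨ lincomb-++ cx _ (x-prefix t≤v) head ⟨
                lincomb (cx ++ (cs ∘ (λ i → inject≤ i p≤r))) basis ∎
              where open ≈ᴹ-Reasoning

      dim-U+ : ∀ {t p} → t ≤ v → SplitsAt lead t p → HasDim (U t ⊕ K) (t + p)
      dim-U+ t≤v sp = basis , basis∈ , basis-independent , basis-spanning
        where open U+K t≤v sp

      covers-at-lead : ∀ ι → suc (toℕ (lead ι)) ≤ v → Covers (U (toℕ (lead ι))) (U (suc (toℕ (lead ι)))) K
      covers-at-lead ι l<v y = to , from
        where
          l = toℕ (lead ι)
          to : (U l ⊕ K) y → (U (suc l) ⊕ K) y
          to (u , w , u∈ , w∈ , y≈) = u , w , U-mono (ℕₚ.n≤1+n l) l<v u u∈ , w∈ , y≈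
          from : (U (suc l) ⊕ K) y → (U l ⊕ K) y
          from (u , w , u∈ , w∈ , y≈) =
            eliminate u (vec ι) (lead ι) c≉0 , w +ᴹ (β *ₗ vec ι) , u′∈ , w′∈ ,
            ≈ᴹ-trans y≈ (≈ᴹ-sym ([x-az]+[y+az]≈x+y u w β (vec ι)))
            where
              c≉0 = proj₁ (isLead ι)
              β = coord u (lead ι) *F inv (coord (vec ι) (lead ι)) c≉0
              u′∈ = Below⇒∈U (ℕₚ.<⇒≤ l<v)
                      (Below-eliminate (lead ι) refl (∈U⇒Below l<v u∈) (Lead⇒Below (isLead ι)) c≉0)
              w′∈ = close+ K w∈ (close* K β (vec∈K ι))

      ∈join-at-lead : ∀ ι → let l = toℕ (lead ι) in suc l ≤ v →
                      InJoinSet (Grass (U l) (rank ∸ suc (toℕ ι))) (U l) (U (suc l)) (QuotGrass (U (suc l)) (toℕ ι)) K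
      ∈join-at-lead ι l<v =
        U l ∩ˢ K , U (suc l) +ˢ K ,
        ((λ _ → proj₁) , dim-U∩ (ℕₚ.<⇒≤ l<v) (splitsAt-lead-suc lead decreasing ι)) ,
        (λ _ → proj₁) , U⊆U+K ,
        (U⊆U+K , suc l , dim-U l<v , dim-U+ l<v (splitsAt-lead lead decreasing ι)) ,
        ((λ _ → (λ z → z) , (λ z → z)) , (λ _ → (λ z → z) , (λ z → z)) , covers-at-lead ι l<v)
        where
          l = toℕ (lead ι)
          U⊆U+K : U (suc l) ⊆ (U (suc l) +ˢ K)
          U⊆U+K y y∈ = y , 0ᴹ , y∈ , has0 K , ≈ᴹ-sym (+ᴹ-identityʳ y)

    module Decomposition (k s : ℕ) (k≤v : k ≤ v) (s<k : s < k) where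

      Layer : ℕ → Subspace → Set (c ⊔ ℓ ⊔ lsuc (m ⊔ ℓm))
      Layer a = InJoinSet (Grass (U (a ∸ 1)) (k ∸ s ∸ 1)) (U (a ∸ 1)) (U a) (QuotGrass (U a) s)

      dim≡k⇒layer : ∀ {K} → dim K ≡ k → ∃ λ l → k ≤ s + suc l × suc l + s ≤ v × Layer (suc l) K
      dim≡k⇒layer {K} (b , b∈ , b-independent , b-spans) = l , k≤s+1+l , 1+l+s≤v , layer
        where
          E = echelonBasis K b b∈ b-spans
          open EchelonBasis E
          rank≡k : rank ≡ k
          rank≡k = echelonBasis-rank K b b∈ b-spans b-independent
          s<rank = subst (s <_) (sym rank≡k) s<k
          ι = Fin.fromℕ< s<rank
          ι≡s : toℕ ι ≡ s
          ι≡s = Finₚ.toℕ-fromℕ< s<rank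
          l = toℕ (lead ι)
          1+l+s≤v : suc l + s ≤ v
          1+l+s≤v = subst (λ i → l + i < v) ι≡s (lead+index< lead decreasing ι)
          k≤s+1+l : k ≤ s + suc l
          k≤s+1+l = begin
              k                    ≤⟨ ℕₚ.m≤n+m∸n k (suc s) ⟩
              suc s + (k ∸ suc s)  ≤⟨ ℕₚ.+-monoʳ-≤ (suc s) (subst₂ (λ r i → r ∸ suc i ≤ l) rank≡k ι≡s
                                                       (remaining≤lead lead decreasing ι)) ⟩
              suc s + l            ≡⟨ ℕₚ.+-suc s l ⟨
              s + suc l            ∎
            where open ℕₚ.≤-Reasoning
          layer : Layer (suc l) K
          layer = subst₂ (λ d i → InJoinSet (Grass (U l) d) (U l) (U (suc l)) (QuotGrass (U (suc l)) i) K)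
                    (trans (cong₂ (λ r i → r ∸ suc i) rank≡k ι≡s) (sym (m∸n∸1≡m∸[1+n] k s))) ι≡s
                    (∈join-at-lead E ι (ℕₚ.≤-trans (ℕₚ.m≤m+n (suc l) s) 1+l+s≤v))

      layer⇒echelonBasis : ∀ l {K} → Layer (suc l) K → EchelonBasis K
      layer⇒echelonBasis l {K} (K₁ , K₂ , (_ , (b₁ , b₁∈ , _ , b₁-spans)) , _ , _ ,
                                   (_ , d , _ , (b₂ , b₂∈ , _ , b₂-spans)) , (U∩K≐K₁ , U+K≐K₂ , covers)) =
          echelonBasis K (b₁ ++ w) g∈K K⊆span
        where
          split : ∀ j → (U l ⊕ K) (b₂ j)
          split j = proj₂ (covers (b₂ j)) (proj₂ (U+K≐K₂ (b₂ j)) (b₂∈ j))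
          u w : Fin (d + s) → Carrierᴹ
          u j = proj₁ (split j)
          w j = proj₁ (proj₂ (split j))
          u∈ : ∀ j → U l ∋ u j
          u∈ j = proj₁ (proj₂ (proj₂ (split j)))
          w∈ : ∀ j → K ∋ w j
          w∈ j = proj₁ (proj₂ (proj₂ (proj₂ (split j))))
          b₂≈u+w : ∀ j → b₂ j ≈ᴹ u j +ᴹ w j
          b₂≈u+w j = proj₂ (proj₂ (proj₂ (proj₂ (split j))))
          g∈K : ∀ i → K ∋ (b₁ ++ w) i
          g∈K = ↑-elim {P = λ i → K ∋ (b₁ ++ w) i}
            (λ a → subst (K ∋_) (sym (lookup-++ˡ b₁ w a)) (proj₂ (proj₂ (U∩K≐K₁ (b₁ a)) (b₁∈ a))))
            (λ j → subst (K ∋_) (sym (lookup-++ʳ b₁ w j)) (w∈ j))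
          -- y ∈ K ⊆ K₂ decomposes along u + w, and its u-part lies in U l ∩ K = K₁.
          K⊆span : ∀ y → K ∋ y → Span (b₁ ++ w) y
          K⊆span y y∈ = c₁ ++ c₂ , ≈ᴹ-trans (x≈[x-y]+y y Lw)
                          (≈ᴹ-trans (+ᴹ-congʳ (proj₂ (b₁-spans y′ y′∈K₁))) (≈ᴹ-sym (lincomb-++ c₁ c₂ b₁ w)))
            where
              y∈K₂ = proj₁ (U+K≐K₂ y) (0ᴹ , y , has0 (U (suc l)) , y∈ , ≈ᴹ-sym (+ᴹ-identityˡ y))
              c₂ = proj₁ (b₂-spans y y∈K₂)
              Lu = lincomb c₂ u
              Lw = lincomb c₂ w
              y≈Lu+Lw : y ≈ᴹ Lu +ᴹ Lw
              y≈Lu+Lw = ≈ᴹ-trans (proj₂ (b₂-spans y y∈K₂))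
                          (≈ᴹ-trans (lincomb-cong (λ _ → R.refl) b₂≈u+w) (lincomb-distribʳ c₂ u w))
              y′ = y +ᴹ ((-F 1#) *ₗ Lw)
              y′∈K₁ : K₁ ∋ y′
              y′∈K₁ = proj₁ (U∩K≐K₁ y′)
                (resp (U l) (≈ᴹ-sym (≈ᴹ-trans (+ᴹ-congʳ y≈Lu+Lw) ([x+y]-y≈x Lu Lw))) (∋-lincomb (U l) c₂ u∈) ,
                 ∋-sub K y∈ (∋-lincomb K c₂ w∈))
              c₁ = proj₁ (b₁-spans y′ y′∈K₁)

      -- Comparing dimensions of U l ∩ K, U (l + 1) + K and U l + K with the echelon counts.
      layer⇒splits : ∀ l {K} → suc l ≤ v → Layer (suc l) K → (E : EchelonBasis K) →
                     SplitsAt (EchelonBasis.lead E) (suc l) s × SplitsAt (EchelonBasis.lead E) l (suc s) ×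
                     EchelonBasis.rank E ≡ k
      layer⇒splits l {K} l<v
        (K₁ , K₂ , (_ , dim-K₁) , _ , _ , (_ , d , dim-U-d , dim-K₂) , (U∩K≐K₁ , U+K≐K₂ , covers)) E =
          subst (SplitsAt lead (suc l)) p≡s sp , subst (SplitsAt lead l) p′≡1+s sp′ , rank≡k
        where
          open EchelonBasis E
          l≤v = ℕₚ.<⇒≤ l<v
          p = proj₁ (splitsAt-exists lead decreasing (suc l))
          sp = proj₂ (splitsAt-exists lead decreasing (suc l))
          p′ = proj₁ (splitsAt-exists lead decreasing l)
          sp′ = proj₂ (splitsAt-exists lead decreasing l)
          d≡1+l : d ≡ suc l
          d≡1+l = HasDim-unique dim-U-d (dim-U l<v)
          1+l+p≡d+s : suc l + p ≡ d + s
          1+l+p≡d+s = HasDim-unique (dim-U+ E l<v sp) (HasDim-resp (≐-sym U+K≐K₂) dim-K₂)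
          l+p′≡1+l+p : l + p′ ≡ suc l + p
          l+p′≡1+l+p = HasDim-unique (HasDim-resp covers (dim-U+ E l≤v sp′)) (dim-U+ E l<v sp)
          rank∸p′≡ : rank ∸ p′ ≡ k ∸ s ∸ 1
          rank∸p′≡ = HasDim-unique (dim-U∩ E l≤v sp′) (HasDim-resp (≐-sym U∩K≐K₁) dim-K₁)
          p≡s : p ≡ s
          p≡s = ℕₚ.+-cancelˡ-≡ (suc l) _ _ (trans 1+l+p≡d+s (cong (_+ s) d≡1+l))
          p′≡1+s : p′ ≡ suc s
          p′≡1+s = trans (ℕₚ.+-cancelˡ-≡ l _ _ (trans l+p′≡1+l+p (sym (ℕₚ.+-suc l p)))) (cong suc p≡s)
          rank≡k : rank ≡ k
          rank≡k = begin
              rank                 ≡⟨ ℕₚ.m+[n∸m]≡n (proj₁ sp′) ⟨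
              p′ + (rank ∸ p′)     ≡⟨ cong₂ _+_ p′≡1+s (trans rank∸p′≡ (m∸n∸1≡m∸[1+n] k s)) ⟩
              suc s + (k ∸ suc s)  ≡⟨ ℕₚ.m+[n∸m]≡n s<k ⟩
              k                    ∎
            where open ≡-Reasoning

      layer⇒dim≡k : ∀ l {K} → suc l ≤ v → Layer (suc l) K → dim K ≡ k
      layer⇒dim≡k l {K} l<v L = subst (dim K ≡_) (proj₂ (proj₂ (layer⇒splits l l<v L E))) (dim-echelonBasis E)
        where E = layer⇒echelonBasis l {K} L

      -- In a common echelon basis, layer l has s leads above l, layer l′ has s + 1 leads from l′ on.
      layers-ordered : ∀ l l′ {K} → suc l ≤ v → suc l′ ≤ v → Layer (suc l) K → Layer (suc l′) K → ¬ l < l′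
      layers-ordered l l′ {K} l<v l′<v L L′ l<l′ = ℕₚ.n≮n s
        (splitsAt-antitone (EchelonBasis.lead E) l<l′ (proj₁ (layer⇒splits l l<v L E))
                                                      (proj₁ (proj₂ (layer⇒splits l′ l′<v L′ E))))
        where E = layer⇒echelonBasis l {K} L

      layer-unique : ∀ l l′ {K} → suc l ≤ v → suc l′ ≤ v → Layer (suc l) K → Layer (suc l′) K → l ≡ l′
      layer-unique l l′ {K} l<v l′<v L L′ with ℕₚ.<-cmp l l′
      ... | tri< l<l′ _ _ = ⊥-elim (layers-ordered l l′ {K} l<v l′<v L L′ l<l′)
      ... | tri≈ _ l≡l′ _ = l≡l′
      ... | tri> _ _ l′<l = ⊥-elim (layers-ordered l′ l {K} l′<v l<v L′ L l′<l)

      layer-index : ∀ {i} → i ≤ v ∸ k → ∃ λ l → v ∸ s ∸ i ≡ suc l × suc l ≤ v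
      layer-index {i} i≤ = v ∸ s ∸ suc i , m∸n≡1+m∸[1+n] i<v∸s ,
                           subst (_≤ v) (m∸n≡1+m∸[1+n] i<v∸s) (ℕₚ.≤-trans (ℕₚ.m∸n≤m _ i) (ℕₚ.m∸n≤m v s))
        where i<v∸s = ℕₚ.≤-<-trans i≤ (ℕₚ.∸-monoʳ-< s<k k≤v)

      dim≡k⇒piece : ∀ {K} → dim K ≡ k → ∃ λ i → i ≤ v ∸ k × Layer (v ∸ s ∸ i) K
      dim≡k⇒piece {K} dim≡k = v ∸ s ∸ suc l , i≤v∸k , subst (λ a → Layer a K) (sym a≡1+l) L
        where
          l = proj₁ (dim≡k⇒layer {K} dim≡k)
          k≤s+1+l = proj₁ (proj₂ (dim≡k⇒layer {K} dim≡k))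
          1+l+s≤v = proj₁ (proj₂ (proj₂ (dim≡k⇒layer {K} dim≡k)))
          L : Layer (suc l) K
          L = proj₂ (proj₂ (proj₂ (dim≡k⇒layer {K} dim≡k)))
          a≡1+l : v ∸ s ∸ (v ∸ s ∸ suc l) ≡ suc l
          a≡1+l = ℕₚ.m∸[m∸n]≡n (ℕₚ.m+n≤o⇒m≤o∸n (suc l) 1+l+s≤v)
          i≤v∸k : v ∸ s ∸ suc l ≤ v ∸ k
          i≤v∸k = subst (_≤ v ∸ k) (sym (ℕₚ.∸-+-assoc v s (suc l))) (ℕₚ.∸-monoʳ-≤ v k≤s+1+l)

      piece⇒dim≡k : ∀ {i K} → i ≤ v ∸ k → Layer (v ∸ s ∸ i) K → dim K ≡ k
      piece⇒dim≡k {K = K} i≤v∸k P = layer⇒dim≡k l {K} l<v (subst (λ a → Layer a K) a≡1+l P)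
        where
          l = proj₁ (layer-index i≤v∸k)
          a≡1+l = proj₁ (proj₂ (layer-index i≤v∸k))
          l<v = proj₂ (proj₂ (layer-index i≤v∸k))

      piece-unique : ∀ {i j K} → i ≤ v ∸ k → j ≤ v ∸ k → Layer (v ∸ s ∸ i) K → Layer (v ∸ s ∸ j) K → i ≡ j
      piece-unique {i} {j} {K} i≤v∸k j≤v∸k Pᵢ Pⱼ = begin
          i                    ≡⟨ ℕₚ.m∸[m∸n]≡n (≤v∸s i≤v∸k) ⟨
          v ∸ s ∸ (v ∸ s ∸ i)  ≡⟨ cong (v ∸ s ∸_) (trans aᵢ≡ (trans (cong suc l≡l′) (sym aⱼ≡))) ⟩
          v ∸ s ∸ (v ∸ s ∸ j)  ≡⟨ ℕₚ.m∸[m∸n]≡n (≤v∸s j≤v∸k) ⟩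
          j                    ∎
        where
          open ≡-Reasoning
          ≤v∸s : ∀ {i} → i ≤ v ∸ k → i ≤ v ∸ s
          ≤v∸s i≤v∸k = ℕₚ.≤-trans i≤v∸k (ℕₚ.∸-monoʳ-≤ v (ℕₚ.<⇒≤ s<k))
          l = proj₁ (layer-index i≤v∸k)
          aᵢ≡ = proj₁ (proj₂ (layer-index i≤v∸k))
          l<v = proj₂ (proj₂ (layer-index i≤v∸k))
          l′ = proj₁ (layer-index j≤v∸k)
          aⱼ≡ = proj₁ (proj₂ (layer-index j≤v∸k))
          l′<v = proj₂ (proj₂ (layer-index j≤v∸k))
          l≡l′ = layer-unique l l′ {K} l<v l′<v (subst (λ a → Layer a K) aᵢ≡ Pᵢ) (subst (λ a → Layer a K) aⱼ≡ Pⱼ)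

-- Gaussian binomial coefficients

open ≡-Reasoning

∑< : ℕ → (ℕ → ℕ) → ℕ
∑< n f = sum (applyUpTo f n)

∑<-cong : ∀ n {f g : ℕ → ℕ} → (∀ i → i < n → f i ≡ g i) → ∑< n f ≡ ∑< n g
∑<-cong zero f≡g = refl
∑<-cong (suc n) f≡g = cong₂ _+_ (f≡g 0 (s≤s z≤n)) (∑<-cong n (λ i i<n → f≡g (suc i) (s≤s i<n)))

∑<-distrib-+ : ∀ n (f g : ℕ → ℕ) → ∑< n (λ i → f i + g i) ≡ ∑< n f + ∑< n g
∑<-distrib-+ zero f g = refl
∑<-distrib-+ (suc n) f g = trans (cong (f 0 + g 0 +_) (∑<-distrib-+ n (f ∘ suc) (g ∘ suc)))
  (solve 4 (λ a b c d → (a :+ b) :+ (c :+ d) := (a :+ c) :+ (b :+ d)) refl (f 0) (g 0) (∑< n (f ∘ suc)) (∑< n (g ∘ suc)))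

∑<-*ˡ : ∀ n c (f : ℕ → ℕ) → ∑< n (λ i → c * f i) ≡ c * ∑< n f
∑<-*ˡ zero c f = sym (ℕₚ.*-zeroʳ c)
∑<-*ˡ (suc n) c f = trans (cong (c * f 0 +_) (∑<-*ˡ n c (f ∘ suc))) (sym (ℕₚ.*-distribˡ-+ c (f 0) _))

∑<-last : ∀ n (f : ℕ → ℕ) → ∑< (suc n) f ≡ ∑< n f + f n
∑<-last n f = begin
  sum (applyUpTo f (suc n))                 ≡⟨ cong sum (applyUpTo-∷ʳ f n) ⟨
  sum (applyUpTo f n List.++ [ f n ])       ≡⟨ sum-++ (applyUpTo f n) [ f n ] ⟩
  ∑< n f + (f n + 0)                        ≡⟨ cong (∑< n f +_) (ℕₚ.+-identityʳ (f n)) ⟩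
  ∑< n f + f n                              ∎

gauss-above : ∀ q {n k} → n < k → gauss q n k ≡ 0
gauss-above q {zero} {suc k} _ = refl
gauss-above q {suc n} {suc k} (s≤s n<k)
  rewrite gauss-above q n<k | gauss-above q (ℕₚ.m<n⇒m<1+n n<k) = ℕₚ.*-zeroʳ (q ^ suc k)

gauss-diag : ∀ q n → gauss q n n ≡ 1
gauss-diag q zero = refl
gauss-diag q (suc n) rewrite gauss-diag q n | gauss-above q (ℕₚ.n<1+n n) | ℕₚ.*-zeroʳ (q ^ suc n) = refl

-- With m = v − k and j = k − s − 1, the right-hand side of the counting identity.
layerSum : ℕ → ℕ → ℕ → ℕ → ℕ
layerSum q m j s = ∑< (suc m) (λ i → q ^ ((m ∸ i) * (s + 1)) * gauss q (m + j ∸ i) j * gauss q (s + i) s)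

pow-step : ∀ q m i s → i < suc m → q ^ ((suc m ∸ i) * (s + 1)) ≡ q ^ (s + 1) * q ^ ((m ∸ i) * (s + 1))
pow-step q m i s i≤m =
  trans (cong (λ e → q ^ (e * (s + 1))) (ℕₚ.+-∸-assoc 1 (ℕₚ.≤-pred i≤m))) (ℕₚ.^-distribˡ-+-* q (s + 1) _)

layerSum≡gauss : ∀ q m j s → layerSum q m j s ≡ gauss q (suc (m + j + s)) (suc (j + s))
layerSum≡gauss q zero j s
  rewrite ℕₚ.+-identityʳ s | gauss-diag q j | gauss-diag q s | gauss-diag q (suc (j + s)) = refl
layerSum≡gauss q (suc m) zero s = begin
    layerSum q (suc m) 0 s
      ≡⟨ ∑<-last (suc m) term ⟩
    ∑< (suc m) term + term (suc m)
      ≡⟨ cong₂ _+_ (trans (∑<-cong (suc m) term-step) (∑<-*ˡ (suc m) (q ^ (s + 1)) term′)) last-term ⟩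
    q ^ (s + 1) * layerSum q m 0 s + gauss q (s + suc m) s
      ≡⟨ cong₂ _+_ (cong₂ _*_ (cong (q ^_) (ℕₚ.+-comm s 1)) (layerSum≡gauss q m 0 s))
                   (cong (λ n → gauss q n s) s+1+m≡N) ⟩
    q ^ suc s * gauss q N (suc s) + gauss q N s
      ≡⟨ ℕₚ.+-comm (q ^ suc s * gauss q N (suc s)) (gauss q N s) ⟩
    gauss q (suc N) (suc s) ∎
  where
    N = suc (m + 0 + s)
    term term′ : ℕ → ℕ
    term i = q ^ ((suc m ∸ i) * (s + 1)) * gauss q (suc m + 0 ∸ i) 0 * gauss q (s + i) s
    term′ i = q ^ ((m ∸ i) * (s + 1)) * gauss q (m + 0 ∸ i) 0 * gauss q (s + i) s
    term-step : ∀ i → i < suc m → term i ≡ q ^ (s + 1) * term′ i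
    term-step i i≤m = trans (cong (λ x → x * 1 * gauss q (s + i) s) (pow-step q m i s i≤m))
      (solve 3 (λ a b c → (a :* b) :* con 1 :* c := a :* (b :* con 1 :* c)) refl
         (q ^ (s + 1)) (q ^ ((m ∸ i) * (s + 1))) (gauss q (s + i) s))
    last-term : term (suc m) ≡ gauss q (s + suc m) s
    last-term rewrite ℕₚ.n∸n≡0 m = ℕₚ.+-identityʳ _
    s+1+m≡N : s + suc m ≡ N
    s+1+m≡N = trans (ℕₚ.+-suc s m) (cong suc (trans (ℕₚ.+-comm s m) (cong (_+ s) (sym (ℕₚ.+-identityʳ m)))))
layerSum≡gauss q (suc m) (suc j) s = begin
    layerSum q (suc m) (suc j) s
      ≡⟨ ∑<-cong (suc (suc m)) pascal ⟩
    ∑< (suc (suc m)) (λ i → low i + high i)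
      ≡⟨ ∑<-distrib-+ (suc (suc m)) low high ⟩
    layerSum q (suc m) j s + ∑< (suc (suc m)) high
      ≡⟨ cong (layerSum q (suc m) j s +_) (trans (∑<-last (suc m) high) (cong (∑< (suc m) high +_) last-high)) ⟩
    layerSum q (suc m) j s + (∑< (suc m) high + 0)
      ≡⟨ cong (layerSum q (suc m) j s +_) (trans (ℕₚ.+-identityʳ _)
           (trans (∑<-cong (suc m) high-step) (∑<-*ˡ (suc m) (q ^ suc j * q ^ (s + 1)) term′))) ⟩
    layerSum q (suc m) j s + (q ^ suc j * q ^ (s + 1)) * layerSum q m (suc j) s
      ≡⟨ cong₂ _+_ (trans (layerSum≡gauss q (suc m) j s) (cong (λ n → gauss q n (suc (j + s))) N≡))
                   (cong₂ _*_ pow≡ (layerSum≡gauss q m (suc j) s)) ⟩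
    gauss q (suc (suc m + suc j + s)) (suc (suc j + s)) ∎
  where
    low high term′ : ℕ → ℕ
    low i = q ^ ((suc m ∸ i) * (s + 1)) * gauss q (suc m + j ∸ i) j * gauss q (s + i) s
    high i = q ^ ((suc m ∸ i) * (s + 1)) * (q ^ suc j * gauss q (suc m + j ∸ i) (suc j)) * gauss q (s + i) s
    term′ i = q ^ ((m ∸ i) * (s + 1)) * gauss q (m + suc j ∸ i) (suc j) * gauss q (s + i) s
    pascal : ∀ i → i < suc (suc m) →
             q ^ ((suc m ∸ i) * (s + 1)) * gauss q (suc m + suc j ∸ i) (suc j) * gauss q (s + i) s ≡ low i + high i
    pascal i i≤1+m = trans (cong (λ n → q ^ ((suc m ∸ i) * (s + 1)) * gauss q n (suc j) * gauss q (s + i) s) n≡)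
        (solve 5 (λ w b x c d → w :* (b :+ x :* c) :* d := w :* b :* d :+ w :* (x :* c) :* d) refl
           (q ^ ((suc m ∸ i) * (s + 1))) (gauss q (suc m + j ∸ i) j) (q ^ suc j)
           (gauss q (suc m + j ∸ i) (suc j)) (gauss q (s + i) s))
      where
        n≡ : suc m + suc j ∸ i ≡ suc (suc m + j ∸ i)
        n≡ = trans (cong (_∸ i) (ℕₚ.+-suc (suc m) j))
                   (ℕₚ.+-∸-assoc 1 (ℕₚ.≤-trans (ℕₚ.≤-pred i≤1+m) (ℕₚ.m≤m+n (suc m) j)))
    last-high : high (suc m) ≡ 0
    last-high rewrite ℕₚ.n∸n≡0 m | ℕₚ.m+n∸m≡n m j | gauss-above q (ℕₚ.n<1+n j) | ℕₚ.*-zeroʳ (q ^ suc j)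
                    | ℕₚ.*-zeroʳ (q ^ 0) = refl
    high-step : ∀ i → i < suc m → high i ≡ (q ^ suc j * q ^ (s + 1)) * term′ i
    high-step i i≤m = trans (cong₂ (λ x n → x * (q ^ suc j * gauss q n (suc j)) * gauss q (s + i) s)
                                   (pow-step q m i s i≤m) (cong (_∸ i) (sym (ℕₚ.+-suc m j))))
      (solve 5 (λ a b x c d → (a :* b) :* (x :* c) :* d := (x :* a) :* (b :* c :* d)) refl
         (q ^ (s + 1)) (q ^ ((m ∸ i) * (s + 1))) (q ^ suc j) (gauss q (m + suc j ∸ i) (suc j)) (gauss q (s + i) s))
    N≡ : suc (suc m + j + s) ≡ suc m + suc j + s
    N≡ = cong (_+ s) (sym (ℕₚ.+-suc (suc m) j))
    pow≡ : q ^ suc j * q ^ (s + 1) ≡ q ^ suc (suc j + s)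
    pow≡ = trans (sym (ℕₚ.^-distribˡ-+-* q (suc j) (s + 1)))
                 (cong (q ^_) (cong suc (trans (cong (j +_) (ℕₚ.+-comm s 1)) (ℕₚ.+-suc j s))))

GaussDecomposition : ℕ → ℕ → ℕ → ℕ → Set
GaussDecomposition q s v k =
  gauss q v k ≡ sum (map (λ i → q ^ ((v ∸ k ∸ i) * (s + 1)) * gauss q (v ∸ s ∸ i ∸ 1) (k ∸ s ∸ 1) * gauss q (s + i) s)
                         (upTo (suc (v ∸ k))))

gauss-decomposition : ∀ q v k s → k ≤ v → s < k → GaussDecomposition q s v k
gauss-decomposition q v k s k≤v s<k = subst₂ (GaussDecomposition q s) v≡ k≡ (reparametrised (v ∸ k) (k ∸ suc s))
  where
    reparametrised : ∀ m j → GaussDecomposition q s (m + suc (j + s)) (suc (j + s))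
    reparametrised m j = begin
        gauss q (m + suc (j + s)) (suc (j + s))  ≡⟨ cong (λ n → gauss q n (suc (j + s))) V≡ ⟩
        gauss q (suc (m + j + s)) (suc (j + s))  ≡⟨ layerSum≡gauss q m j s ⟨
        layerSum q m j s                         ≡⟨ ∑<-cong (suc m) (λ i _ → sym (term≡ i)) ⟩
        ∑< (suc m) term                          ≡⟨ cong (λ n → ∑< (suc n) term) (sym V∸K≡m) ⟩
        ∑< (suc (V ∸ K)) term                    ≡⟨ cong sum (map-upTo term (suc (V ∸ K))) ⟨
        sum (map term (upTo (suc (V ∸ K))))      ∎
      where
        V = m + suc (j + s)
        K = suc (j + s)
        term : ℕ → ℕ
        term i = q ^ ((V ∸ K ∸ i) * (s + 1)) * gauss q (V ∸ s ∸ i ∸ 1) (K ∸ s ∸ 1) * gauss q (s + i) s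
        V≡ : V ≡ suc (m + j + s)
        V≡ = trans (ℕₚ.+-suc m (j + s)) (cong suc (sym (ℕₚ.+-assoc m j s)))
        V∸K≡m : V ∸ K ≡ m
        V∸K≡m = ℕₚ.m+n∸n≡m m K
        V∸s≡ : V ∸ s ≡ suc (m + j)
        V∸s≡ = trans (cong (_∸ s) V≡) (ℕₚ.m+n∸n≡m (suc (m + j)) s)
        V∸s∸i∸1≡ : ∀ i → V ∸ s ∸ i ∸ 1 ≡ m + j ∸ i
        V∸s∸i∸1≡ i = trans (cong (λ n → n ∸ i ∸ 1) V∸s≡)
                       (trans (ℕₚ.∸-+-assoc (suc (m + j)) i 1) (cong (suc (m + j) ∸_) (ℕₚ.+-comm i 1)))
        term≡ : ∀ i → term i ≡ q ^ ((m ∸ i) * (s + 1)) * gauss q (m + j ∸ i) j * gauss q (s + i) s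
        term≡ i = cong₂ (λ a b → q ^ ((a ∸ i) * (s + 1)) * b * gauss q (s + i) s) V∸K≡m
                        (cong₂ (gauss q) (V∸s∸i∸1≡ i) (cong (_∸ 1) (ℕₚ.m+n∸n≡m (suc j) s)))
    k≡ : suc (k ∸ suc s + s) ≡ k
    k≡ = trans (sym (ℕₚ.+-suc (k ∸ suc s) s)) (ℕₚ.m∸n+n≡m s<k)
    v≡ : v ∸ k + suc (k ∸ suc s + s) ≡ v
    v≡ = trans (cong (v ∸ k +_) k≡) (ℕₚ.m∸n+n≡m k≤v)

theorem3p21 : ∀ {c ℓ m ℓm} (q : ℕ) (F : CommutativeRing c ℓ) → IsFiniteField F q →
    (M : Module F m ℓm) (v : ℕ) → Sub.VDim F M v →
    (U : ℕ → Sub.Subspace F M) → Sub.MaximalChain F M v U →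
    (k s : ℕ) → k ≤ v → s < k →
    let open Sub F M
        Piece : ℕ → Subspace → Set (c ⊔ ℓ ⊔ lsuc (m ⊔ ℓm))
        Piece i = InJoinSet (Grass (U (v ∸ s ∸ i ∸ 1)) (k ∸ s ∸ 1))
                            (U (v ∸ s ∸ i ∸ 1)) (U (v ∸ s ∸ i))
                            (QuotGrass (U (v ∸ s ∸ i)) s)
    in ((K : Subspace) →
          ((dim K ≡ k) → ∃ λ i → i ≤ v ∸ k × Piece i K)
        × ((∃ λ i → i ≤ v ∸ k × Piece i K) → dim K ≡ k)
        × (∀ i j → i ≤ v ∸ k → j ≤ v ∸ k → Piece i K → Piece j K → i ≡ j))
     × (gauss q v k ≡ sum (map (λ i → q ^ ((v ∸ k ∸ i) * (s + 1))
                                       * gauss q (v ∸ s ∸ i ∸ 1) (k ∸ s ∸ 1)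
                                       * gauss q (s + i) s)
                                (upTo (suc (v ∸ k)))))
theorem3p21 q F FF M v V-dim U chain k s k≤v s<k =
    (λ K → dim≡k⇒piece {K} , (λ (i , i≤ , P) → piece⇒dim≡k {i} {K} i≤ P) , (λ i j → piece-unique {i} {j} {K}))
  , gauss-decomposition q v k s k≤v s<k
  where
    open LinearAlgebra F FF M
    open Chain v V-dim U chain
    open Decomposition k s k≤v s<k
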